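{- For any positive integer $n$, $$\Psi_{\mathbb{Z}_n}(x)=\sum_{d\mid n}\mu\!\left(\frac{n}{d}\right)\left((1+x^2)^{\lfloor\frac{d-1}{2}\rfloor}(1+x)^{\frac{1+(-1)^d}{2}}-1\right),$$ and hence $$\mathcal{E}(\mathbb{Z}_n)=\Psi_{\mathbb{Z}_n}(1)=\sum_{d\mid n}\mu\!\left(\frac{n}{d}\right)\left(2^{\lfloor\frac d2\rfloor}-1\right).$$
   Context: Here $\mu$ is the number-theoretic Möbius function and $d$ runs over positive divisors of $n$. For the cyclic group $\mathbb{Z}_n$ and a generating set $\Omega$ with $\Omega=-\Omega$, $0\notin\Omega$, the Cayley graph $C(\mathbb{Z}_n,\Omega)$ has vertex set $\mathbb{Z}_n$ and edges $\{g,h\}$ with $h-g\in\Omega$, with $\mathbb{Z}_n$ acting by translation. Two such Cayley graphs are equivalent if there is a graph isomorphism $f$ between them with $f(g+u)=g+f(u)$ for all $g,u\in\mathbb{Z}_n$. $a_k(\mathbb{Z}_n)$ is the number of equivalence classes of Cayley graphs $C(\mathbb{Z}_n,\Omega)$ with $|\Omega|=k$, $\Psi_{\mathbb{Z}_n}(x)=\sum_{k=1}^{n-1}a_k(\mathbb{Z}_n)x^k$, and $\mathcal{E}(\mathbb{Z}_n)$ is the number of equivalence classes. -}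

module Defs where

open import Data.Bool using (Bool; true; false; if_then_else_)
open import Data.Nat as ℕ using (ℕ; zero; suc; _∸_; _%_; _/_)
open import Data.Nat.DivMod using (m%n<n)
open import Data.Nat.Divisibility using (_∣?_)
open import Data.Nat.Primality using (prime?)
open import Data.Integer as ℤ using (ℤ; +_)
open import Data.Fin as Fin using (Fin; toℕ; fromℕ<)
open import Data.Fin.Subset using (Subset; _∈_; _∉_; ∣_∣)
open import Data.List as List using (List; []; _∷_; upTo; filter; length; map; concatMap)
open import Data.Bool.ListAction using (any)
open import Data.List.Relation.Unary.AllPairs using (AllPairs)
open import Data.List.Relation.Unary.Any using (Any)
open import Data.Product using (Σ; ∃; ∃-syntax; _×_; _,_; proj₁)
open import Function using (_⇔_)
open import Function.Definitions using (Bijective)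
open import Relation.Nullary using (¬_; does)
open import Relation.Nullary.Decidable using (_×-dec_)
open import Relation.Binary.PropositionalEquality using (_≡_)

primeDivisors : ℕ → List ℕ
primeDivisors n = filter (λ p → prime? p ×-dec (p ∣? n)) (upTo (suc n))

μ : ℕ → ℤ
μ n = if any (λ p → does ((p ℕ.* p) ∣? n)) (primeDivisors n)
      then + 0
      else (ℤ.- ℤ.1ℤ) ℤ.^ length (primeDivisors n)

-- Σ_{d ∣ n} g d (n/d), written as a sum over all factorisations n = d · e
-- with 1 ≤ d, e ≤ n (for n ≥ 1 these are exactly the pairs (d , n/d), d ∣ n).
divisorSum : ℕ → (ℕ → ℕ → ℤ) → ℤ
divisorSum n g =
  List.foldr ℤ._+_ (+ 0)
    (concatMap (λ d → concatMap (λ e →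
        if does (d ℕ.* e ℕ.≟ n) then g d e ∷ [] else [])
      (List.map suc (upTo n))) (List.map suc (upTo n)))

-- Polynomials over ℤ as coefficient sequences (coefficient of x^k at k)

Poly : Set
Poly = ℕ → ℤ

sumUpTo : ℕ → (ℕ → ℤ) → ℤ
sumUpTo zero    f = f 0
sumUpTo (suc k) f = sumUpTo k f ℤ.+ f (suc k)

pconst : ℤ → Poly
pconst c zero    = c
pconst c (suc k) = + 0

pX : Poly
pX 1 = ℤ.1ℤ
pX _ = + 0

_p+_ : Poly → Poly → Poly
(p p+ q) k = p k ℤ.+ q k

_p-_ : Poly → Poly → Poly
(p p- q) k = p k ℤ.- q k

_p*_ : Poly → Poly → Poly
(p p* q) k = sumUpTo k (λ i → p i ℤ.* q (k ∸ i))

_p^_ : Poly → ℕ → Poly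
p p^ zero  = pconst ℤ.1ℤ
p p^ suc m = p p* (p p^ m)

scale : ℤ → Poly → Poly
scale c p k = c ℤ.* p k

-- polynomial Σ_{d∣n} μ(n/d) ((1+x²)^⌊(d-1)/2⌋ (1+x)^((1+(-1)^d)/2) - 1)
-- here (1+(-1)^d)/2 is written as 1 ∸ (d % 2)  (1 if d even, 0 if d odd)
psiFormula : ℕ → Poly
psiFormula n k =
  divisorSum n (λ d e →
    scale (μ e)
      ((((pconst ℤ.1ℤ p+ (pX p^ 2)) p^ ((d ∸ 1) / 2))
          p* ((pconst ℤ.1ℤ p+ pX) p^ (1 ∸ (d % 2))))
        p- pconst ℤ.1ℤ) k)

EFormula : ℕ → ℤ
EFormula n = divisorSum n (λ d e → μ e ℤ.* ((+ (2 ℕ.^ (d / 2))) ℤ.- ℤ.1ℤ))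

module _ {m : ℕ} where
  private n = suc m

  _⊕_ : Fin n → Fin n → Fin n
  i ⊕ j = fromℕ< (m%n<n (toℕ i ℕ.+ toℕ j) n)

  ⊝_ : Fin n → Fin n
  ⊝ i = fromℕ< (m%n<n (n ∸ toℕ i) n)

  _⊖_ : Fin n → Fin n → Fin n
  i ⊖ j = i ⊕ (⊝ j)

  data Generated (Ω : Subset n) : Fin n → Set where
    base : ∀ {g} → g ∈ Ω → Generated Ω g
    zro  : Generated Ω Fin.zero
    add  : ∀ {g h} → Generated Ω g → Generated Ω h → Generated Ω (g ⊕ h)
    neg  : ∀ {g} → Generated Ω g → Generated Ω (⊝ g)

  Admissible : Subset n → Set
  Admissible Ω = (∀ g → g ∈ Ω → (⊝ g) ∈ Ω) × (Fin.zero ∉ Ω) × (∀ g → Generated Ω g)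

  Adj : Subset n → Fin n → Fin n → Set
  Adj Ω g h = (h ⊖ g) ∈ Ω

  Equivalent : Subset n → Subset n → Set
  Equivalent Ω Ω' =
    Σ (Fin n → Fin n) λ f →
      Bijective _≡_ _≡_ f
      × (∀ g h → Adj Ω g h ⇔ Adj Ω' (f g) (f h))
      × (∀ g u → f (g ⊕ u) ≡ g ⊕ f u)

  -- number of equivalence classes of Cayley graphs C(ℤ_n,Ω) with P Ω is c:
  -- there is a complete, irredundant list of c representatives
  CayleyOf : (Subset n → Set) → Set
  CayleyOf P = Σ (Subset n) λ Ω → Admissible Ω × P Ω

  NumClasses : (Subset n → Set) → ℕ → Set
  NumClasses P c =
    Σ (List (CayleyOf P)) λ L →
      length L ≡ c
      × AllPairs (λ A B → ¬ Equivalent (proj₁ A) (proj₁ B)) L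
      × (∀ (A : CayleyOf P) → Any (λ B → Equivalent (proj₁ A) (proj₁ B)) L)

-- a_k(ℤ_n) = c   (n = suc m)
a[_,_]≡_ : ℕ → ℕ → ℕ → Set
a[ m , k ]≡ c = NumClasses {m} (λ Ω → ∣ Ω ∣ ≡ k) c

-- 𝓔(ℤ_n) = c : number of classes of Cayley graphs with |Ω| ≥ 1
-- (equivalently 1 ≤ |Ω| ≤ n-1, matching Ψ(1) = Σ_{k=1}^{n-1} a_k)
𝓔[_]≡_ : ℕ → ℕ → Set
𝓔[ m ]≡ c = NumClasses {m} (λ Ω → 1 ℕ.≤ ∣ Ω ∣) c

-- Every equivariant isomorphism of Cayley graphs of ℤₙ is a translation, so the equivalence classes
-- with |Ω| = k are just the connection sets Ω with |Ω| = k. Such an Ω is determined by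
-- T = Ω ∩ [1, ⌊n/2⌋], each j ∈ T contributing the pair {j, n − j} (a single element when 2j = n),
-- and Ω generates ℤₙ iff gcd(n, T) = 1. Counted by the size of the corresponding Ω, all subsets
-- T ⊆ [1, ⌊d/2⌋] have generating function (1 + x²)^⌊(d−1)/2⌋ (1 + x)^[d even]. Sorting them by
-- g = gcd(d, T), i.e. writing T = g·T′ with T′ ⊆ [1, ⌊(d/g)/2⌋] coprime to d/g, expresses this
-- polynomial as a divisor sum of the coprime ones, and Möbius inversion yields Ψ; the −1 removes
-- T = ∅, which is coprime to n only for n = 1. Counting every T once gives 𝓔 = Ψ(1) in the same way.

module Submission where

open import Defs
open import Data.Nat using (ℕ; suc; _≤_; _<_)
open import Data.Integer using (ℤ; +_)
open import Data.Product using (Σ; _×_)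
open import Data.Sum using (_⊎_)
open import Relation.Binary.PropositionalEquality using (_≡_)

open import Data.Bool using (Bool; true; false; if_then_else_; T; not; _∧_; _∨_)
import Data.Bool.Properties as BoolP
open import Data.Bool.ListAction using (all; any)
open import Data.Empty using (⊥; ⊥-elim)
open import Data.Fin as Fin using (Fin; toℕ; fromℕ<)
import Data.Fin.Properties as FinP
open import Data.Fin.Subset as Sub using (Subset; ∣_∣)
import Data.Fin.Subset.Properties as SubP
open import Data.Integer as ℤ using (0ℤ; 1ℤ; _+_; _*_; -_; _-_)
import Data.Integer.Properties as ℤP
open import Algebra.Properties.CommutativeSemigroup ℤP.+-commutativeSemigroup using (interchange)
open import Data.Integer.Tactic.RingSolver using (solve-∀)
open import Data.List as List using (List; []; _∷_; _++_; map; length)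
import Data.List.Properties as LP
open import Data.List.Membership.Propositional using (_∈_; mapWith∈; find; lose)
open import Data.List.Membership.Propositional.Properties
  using (∈-++⁻; ∈-++⁺ˡ; ∈-++⁺ʳ; ∈-map⁻; ∈-map⁺; ∈-filter⁺; ∈-filter⁻; ∈-upTo⁺)
open import Data.List.Membership.Setoid.Properties using (length-mapWith∈)
open import Data.List.Relation.Unary.All as All using (All; []; _∷_)
open import Data.List.Relation.Unary.All.Properties using (All¬⇒¬Any)
open import Data.List.Relation.Unary.AllPairs as AllPairs using (AllPairs; []; _∷_)
import Data.List.Relation.Unary.AllPairs.Properties as AllPairsₚ
open import Data.List.Relation.Unary.Any using (Any; here; there)
open import Data.List.Relation.Unary.Any.Properties using (any⁺; any⁻; mapWith∈⁺)
open import Data.List.Relation.Unary.Unique.Propositional using (Unique)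
open import Data.Nat as ℕ using (zero; z≤n; s≤s; _∸_; _/_; _%_; _≡ᵇ_; _≤ᵇ_; _≟_; _≤?_)
import Data.Nat.DivMod as DM
open import Data.Nat.Coprimality using (Coprime; coprime-divisor)
open import Data.Nat.Divisibility
  using (_∣_; _∣?_; divides; ∣-refl; ∣-trans; m∣m*n; n∣m*n; *-monoʳ-∣; *-cancelˡ-∣; ∣⇒≤; _∣0; 0∣⇒≡0; ∣1⇒≡1; ∣m+n∣m⇒∣n; ∣m∣n⇒∣m+n)
open import Data.Nat.GCD using (gcd; gcd-GCD; gcd[m,n]∣m; gcd[m,n]∣n; c*gcd[m,n]≡gcd[cm,cn]; module Bézout)
open import Data.Nat.ListAction using (product)
open import Data.Nat.Primality using (Prime; prime?; euclidsLemma; prime⇒irreducible; prime⇒nonZero; ¬prime[1])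
open import Data.Nat.Primality.Factorisation using (factorise)
import Data.Nat.Properties as ℕP
open import Data.Product using (_,_; proj₁; proj₂; ∃)
open import Data.Sum using (inj₁; inj₂; reduce)
open import Data.Vec using (lookup; tabulate)
import Data.Vec.Properties as VecP
open import Function using (_⇔_; mk⇔; Equivalence; case_of_)
import Function.Construct.Identity as Identity
open import Relation.Binary.PropositionalEquality
open import Relation.Nullary using (Dec; yes; no; does; ¬_)
open import Relation.Nullary.Decidable using (dec-true; dec-false; does-⇔; _×-dec_; T?)

∑ : {A : Set} → List A → (A → ℤ) → ℤ
∑ []       f = 0ℤ
∑ (x ∷ xs) f = f x + ∑ xs f

syntax ∑ xs (λ x → e) = ∑[ x ∈ xs ] e

when : Bool → ℤ → ℤ
when true  v = v
when false v = 0ℤ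

range : ℕ → ℕ → List ℕ
range a zero    = []
range a (suc k) = a ∷ range (suc a) k

∑-++ : {A : Set} (xs ys : List A) (f : A → ℤ) → ∑ (xs ++ ys) f ≡ ∑ xs f + ∑ ys f
∑-++ []       ys f = sym (ℤP.+-identityˡ _)
∑-++ (x ∷ xs) ys f = trans (cong (λ s → f x + s) (∑-++ xs ys f)) (sym (ℤP.+-assoc (f x) _ _))

∑-cong-∈ : {A : Set} (xs : List A) {f g : A → ℤ} → (∀ x → x ∈ xs → f x ≡ g x) → ∑ xs f ≡ ∑ xs g
∑-cong-∈ []       eq = refl
∑-cong-∈ (x ∷ xs) eq = cong₂ _+_ (eq x (here refl)) (∑-cong-∈ xs (λ y y∈ → eq y (there y∈)))

∑-cong : {A : Set} (xs : List A) {f g : A → ℤ} → (∀ x → f x ≡ g x) → ∑ xs f ≡ ∑ xs g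
∑-cong xs eq = ∑-cong-∈ xs (λ x _ → eq x)

∑-zero : {A : Set} (xs : List A) (f : A → ℤ) → (∀ x → x ∈ xs → f x ≡ 0ℤ) → ∑ xs f ≡ 0ℤ
∑-zero []       f eq = refl
∑-zero (x ∷ xs) f eq =
  trans (cong₂ _+_ (eq x (here refl)) (∑-zero xs f (λ y y∈ → eq y (there y∈)))) refl

∑-+ : {A : Set} (xs : List A) (f g : A → ℤ) → ∑[ x ∈ xs ] (f x + g x) ≡ ∑ xs f + ∑ xs g
∑-+ []       f g = refl
∑-+ (x ∷ xs) f g = trans (cong (λ s → f x + g x + s) (∑-+ xs f g)) (interchange (f x) (g x) _ _)

∑-*ˡ : {A : Set} (xs : List A) (c : ℤ) (f : A → ℤ) → ∑[ x ∈ xs ] (c * f x) ≡ c * ∑ xs f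
∑-*ˡ []       c f = sym (ℤP.*-zeroʳ c)
∑-*ˡ (x ∷ xs) c f = trans (cong (λ s → c * f x + s) (∑-*ˡ xs c f)) (sym (ℤP.*-distribˡ-+ c (f x) _))

∑-neg : {A : Set} (xs : List A) (f : A → ℤ) → ∑[ x ∈ xs ] (- f x) ≡ - ∑ xs f
∑-neg []       f = refl
∑-neg (x ∷ xs) f = trans (cong (λ s → - f x + s) (∑-neg xs f)) (sym (ℤP.neg-distrib-+ (f x) _))

∑-- : {A : Set} (xs : List A) (f g : A → ℤ) → ∑[ x ∈ xs ] (f x - g x) ≡ ∑ xs f - ∑ xs g
∑-- xs f g = trans (∑-+ xs f (λ x → - g x)) (cong (λ s → ∑ xs f + s) (∑-neg xs g))

∑-map : {A B : Set} (g : A → B) (xs : List A) (f : B → ℤ) → ∑ (map g xs) f ≡ ∑[ x ∈ xs ] f (g x)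
∑-map g []       f = refl
∑-map g (x ∷ xs) f = cong (λ s → f (g x) + s) (∑-map g xs f)

∑-comm : {A B : Set} (xs : List A) (ys : List B) (f : A → B → ℤ) →
         ∑[ x ∈ xs ] ∑[ y ∈ ys ] f x y ≡ ∑[ y ∈ ys ] ∑[ x ∈ xs ] f x y
∑-comm []       ys f = sym (∑-zero ys _ (λ _ _ → refl))
∑-comm (x ∷ xs) ys f = trans (cong (λ s → ∑ ys (f x) + s) (∑-comm xs ys f)) (sym (∑-+ ys (f x) _))

when-zero : ∀ b → when b 0ℤ ≡ 0ℤ
when-zero true  = refl
when-zero false = refl

when-+ : ∀ b u v → when b (u + v) ≡ when b u + when b v
when-+ true  u v = refl
when-+ false u v = refl

when-- : ∀ b u v → when b (u - v) ≡ when b u - when b v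
when-- true  u v = refl
when-- false u v = refl

when-*ˡ : ∀ b c v → when b (c * v) ≡ c * when b v
when-*ˡ true  c v = refl
when-*ˡ false c v = sym (ℤP.*-zeroʳ c)

when-∧ : ∀ a b v → when (a ∧ b) v ≡ when a (when b v)
when-∧ true  b v = refl
when-∧ false b v = refl

when-comm : ∀ a b v → when a (when b v) ≡ when b (when a v)
when-comm a b v = trans (sym (when-∧ a b v)) (trans (cong (λ c → when c v) (BoolP.∧-comm a b)) (when-∧ b a v))

when-cong : ∀ b {u v} → (b ≡ true → u ≡ v) → when b u ≡ when b v
when-cong true  eq = eq refl
when-cong false eq = refl

when-∨ : ∀ a b → (a ≡ true → b ≡ true → ⊥) → when (a ∨ b) 1ℤ ≡ when a 1ℤ + when b 1ℤ
when-∨ true  true  a∧b = ⊥-elim (a∧b refl refl)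
when-∨ true  false _   = refl
when-∨ false true  _   = refl
when-∨ false false _   = refl

when-split : ∀ b c v → when c v ≡ when b (when c v) + when (not b) (when c v)
when-split true  c v = sym (ℤP.+-identityʳ _)
when-split false c v = sym (ℤP.+-identityˡ _)

when-·1 : ∀ b v → v * when b 1ℤ ≡ when b v
when-·1 true  v = ℤP.*-identityʳ v
when-·1 false v = ℤP.*-zeroʳ v

∑-when : {A : Set} (xs : List A) (b : Bool) (f : A → ℤ) → ∑[ x ∈ xs ] when b (f x) ≡ when b (∑ xs f)
∑-when xs true  f = refl
∑-when xs false f = ∑-zero xs _ (λ _ _ → refl)

≡ᵇ-true : ∀ {x y} → x ≡ y → (x ≡ᵇ y) ≡ true
≡ᵇ-true {x} {y} = dec-true (x ≟ y)

≡ᵇ-false : ∀ {x y} → ¬ x ≡ y → (x ≡ᵇ y) ≡ false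
≡ᵇ-false {x} {y} = dec-false (x ≟ y)

≡ᵇ-cong : ∀ {x y u v} → x ≡ y ⇔ u ≡ v → (x ≡ᵇ y) ≡ (u ≡ᵇ v)
≡ᵇ-cong {x} {y} {u} {v} x≡y⇔u≡v = does-⇔ x≡y⇔u≡v (x ≟ y) (u ≟ v)

≡ᵇ-sym : ∀ x y → (x ≡ᵇ y) ≡ (y ≡ᵇ x)
≡ᵇ-sym x y = ≡ᵇ-cong {x} {y} {y} {x} (mk⇔ sym sym)

≡ᵇ⇒≡ : ∀ {x y} → (x ≡ᵇ y) ≡ true → x ≡ y
≡ᵇ⇒≡ {x} {y} eq = ℕP.≡ᵇ⇒≡ x y (subst T (sym eq) _)

≤ᵇ-true : ∀ {a b} → a ≤ b → (a ≤ᵇ b) ≡ true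
≤ᵇ-true {a} {b} = dec-true (a ≤? b)

≤ᵇ-false : ∀ {a b} → ¬ a ≤ b → (a ≤ᵇ b) ≡ false
≤ᵇ-false {a} {b} = dec-false (a ≤? b)

when-+≡ᵇ : ∀ a s k v → when (a ℕ.+ s ≡ᵇ k) v ≡ when (a ≤ᵇ k) (when (s ≡ᵇ k ∸ a) v)
when-+≡ᵇ a s k v with a ≤? k
... | yes a≤k rewrite ≤ᵇ-true a≤k = cong (λ b → when b v) (≡ᵇ-cong {a ℕ.+ s} {k} {s} {k ∸ a}
      (mk⇔ (λ a+s≡k → trans (sym (ℕP.m+n∸m≡n a s)) (cong (_∸ a) a+s≡k)) (λ s≡k∸a → trans (cong (a ℕ.+_) s≡k∸a) (ℕP.m+[n∸m]≡n a≤k))))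
... | no a≰k rewrite ≤ᵇ-false a≰k = cong (λ b → when b v) (≡ᵇ-false (λ a+s≡k → a≰k (subst (a ≤_) a+s≡k (ℕP.m≤m+n a s))))

∈-range⁻ : ∀ a k {x} → x ∈ range a k → a ≤ x × x < a ℕ.+ k
∈-range⁻ a (suc k) (here refl) = ℕP.≤-refl , ℕP.m<m+n a (s≤s z≤n)
∈-range⁻ a (suc k) {x} (there x∈) with ∈-range⁻ (suc a) k x∈
... | a<x , x<a+k = ℕP.<⇒≤ a<x , subst (x <_) (sym (ℕP.+-suc a k)) x<a+k

∈-range⁺ : ∀ a k {x} → a ≤ x → x < a ℕ.+ k → x ∈ range a k
∈-range⁺ a zero    a≤x x<a+k = ⊥-elim (ℕP.<-irrefl refl (ℕP.<-≤-trans x<a+k (subst (_≤ _) (sym (ℕP.+-identityʳ a)) a≤x)))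
∈-range⁺ a (suc k) {x} a≤x x<a+k with a ≟ x
... | yes refl = here refl
... | no  a≢x  = there (∈-range⁺ (suc a) k (ℕP.≤∧≢⇒< a≤x a≢x) (subst (x <_) (ℕP.+-suc a k) x<a+k))

∈-range1⁻ : ∀ {k x} → x ∈ range 1 k → 1 ≤ x × x ≤ k
∈-range1⁻ {k} x∈ with ∈-range⁻ 1 k x∈
... | 1≤x , x<1+k = 1≤x , ℕP.≤-pred x<1+k

range-snoc : ∀ a k → range a (suc k) ≡ range a k ++ (a ℕ.+ k ∷ [])
range-snoc a zero    = cong (_∷ []) (sym (ℕP.+-identityʳ a))
range-snoc a (suc k) = cong (a ∷_) (trans (range-snoc (suc a) k) (cong (λ z → range (suc a) k ++ (z ∷ [])) (sym (ℕP.+-suc a k))))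

range-++ : ∀ a k l → range a (k ℕ.+ l) ≡ range a k ++ range (a ℕ.+ k) l
range-++ a zero    l = cong (λ z → range z l) (sym (ℕP.+-identityʳ a))
range-++ a (suc k) l = cong (a ∷_) (trans (range-++ (suc a) k l) (cong (λ z → range (suc a) k ++ range z l) (sym (ℕP.+-suc a k))))

length-range : ∀ a k → length (range a k) ≡ k
length-range a zero    = refl
length-range a (suc k) = cong suc (length-range (suc a) k)

∑-range-suc : ∀ a k (f : ℕ → ℤ) → ∑ (range a (suc k)) f ≡ ∑ (range a k) f + f (a ℕ.+ k)
∑-range-suc a k f = begin
  ∑ (range a (suc k)) f                     ≡⟨ cong (λ xs → ∑ xs f) (range-snoc a k) ⟩
  ∑ (range a k ++ (a ℕ.+ k ∷ [])) f          ≡⟨ ∑-++ (range a k) _ f ⟩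
  ∑ (range a k) f + (f (a ℕ.+ k) + 0ℤ)      ≡⟨ cong (λ s → ∑ (range a k) f + s) (ℤP.+-identityʳ _) ⟩
  ∑ (range a k) f + f (a ℕ.+ k)             ∎
  where open ≡-Reasoning

∑-range-suc-shift : ∀ a k (f : ℕ → ℤ) → ∑ (range (suc a) k) f ≡ ∑[ x ∈ range a k ] f (suc x)
∑-range-suc-shift a zero    f = refl
∑-range-suc-shift a (suc k) f = cong (λ s → f (suc a) + s) (∑-range-suc-shift (suc a) k f)

∑-range-extend : ∀ a k N (f : ℕ → ℤ) → k ≤ N → (∀ x → a ℕ.+ k ≤ x → f x ≡ 0ℤ) →
                 ∑ (range a N) f ≡ ∑ (range a k) f
∑-range-extend a k N f k≤N tail-zero = begin
  ∑ (range a N) f                                       ≡⟨ cong (λ z → ∑ (range a z) f) (sym (ℕP.m+[n∸m]≡n k≤N)) ⟩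
  ∑ (range a (k ℕ.+ (N ∸ k))) f                         ≡⟨ cong (λ xs → ∑ xs f) (range-++ a k (N ∸ k)) ⟩
  ∑ (range a k ++ range (a ℕ.+ k) (N ∸ k)) f             ≡⟨ ∑-++ (range a k) _ f ⟩
  ∑ (range a k) f + ∑ (range (a ℕ.+ k) (N ∸ k)) f       ≡⟨ cong (λ s → ∑ (range a k) f + s) tail≡0 ⟩
  ∑ (range a k) f + 0ℤ                                  ≡⟨ ℤP.+-identityʳ _ ⟩
  ∑ (range a k) f                                       ∎
  where
  open ≡-Reasoning
  tail≡0 = ∑-zero _ f (λ x x∈ → tail-zero x (proj₁ (∈-range⁻ _ (N ∸ k) x∈)))

∑-indicator-∉ : ∀ xs x₀ (f : ℕ → ℤ) → ¬ x₀ ∈ xs → ∑[ x ∈ xs ] when (x ≡ᵇ x₀) (f x) ≡ 0ℤ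
∑-indicator-∉ xs x₀ f x₀∉ = ∑-zero xs _ (λ x x∈ → cong (λ b → when b (f x)) (≡ᵇ-false {x} {x₀} (λ { refl → x₀∉ x∈ })))

∑-range-indicator : ∀ a k x₀ (f : ℕ → ℤ) → a ≤ x₀ → x₀ < a ℕ.+ k →
                    ∑[ x ∈ range a k ] when (x ≡ᵇ x₀) (f x) ≡ f x₀
∑-range-indicator a zero x₀ f a≤x₀ x₀<a+k = ⊥-elim (ℕP.<-irrefl refl (ℕP.<-≤-trans x₀<a+k (subst (_≤ _) (sym (ℕP.+-identityʳ a)) a≤x₀)))
∑-range-indicator a (suc k) x₀ f a≤x₀ x₀<a+k with a ≟ x₀
... | yes refl rewrite ≡ᵇ-true {a} refl = trans (cong (λ s → f a + s) (∑-indicator-∉ (range (suc a) k) a f a∉)) (ℤP.+-identityʳ _)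
  where a∉ = λ a∈ → ℕP.<-irrefl refl (proj₁ (∈-range⁻ (suc a) k a∈))
... | no  a≢x₀ rewrite ≡ᵇ-false a≢x₀ = trans (ℤP.+-identityˡ _)
  (∑-range-indicator (suc a) k x₀ f (ℕP.≤∧≢⇒< a≤x₀ a≢x₀) (subst (x₀ <_) (ℕP.+-suc a k) x₀<a+k))

applyUpTo≡range : ∀ n (f : ℕ → ℕ) a → (∀ i → f i ≡ a ℕ.+ i) → List.applyUpTo f n ≡ range a n
applyUpTo≡range zero    f a f≗a+ = refl
applyUpTo≡range (suc n) f a f≗a+ = cong₂ _∷_ (trans (f≗a+ 0) (ℕP.+-identityʳ a))
  (applyUpTo≡range n (λ i → f (suc i)) (suc a) (λ i → trans (f≗a+ (suc i)) (ℕP.+-suc a i)))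

upTo≡range : ∀ n → List.upTo n ≡ range 0 n
upTo≡range n = applyUpTo≡range n (λ i → i) 0 (λ _ → refl)

map-suc-upTo≡range : ∀ n → map suc (List.upTo n) ≡ range 1 n
map-suc-upTo≡range n = trans (LP.map-upTo suc n) (applyUpTo≡range n suc 1 (λ _ → refl))

length-filter≡∑ : {A : Set} {P : A → Set} (P? : (x : A) → Dec (P x)) (xs : List A) →
                  + length (List.filter P? xs) ≡ ∑[ x ∈ xs ] when (does (P? x)) 1ℤ
length-filter≡∑ P? []       = refl
length-filter≡∑ P? (x ∷ xs) with does (P? x)
... | true  = cong (λ s → 1ℤ + s) (length-filter≡∑ P? xs)
... | false = trans (length-filter≡∑ P? xs) (sym (ℤP.+-identityˡ _))

T-does⁺ : ∀ {P : Set} (P? : Dec P) → P → T (does P?)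
T-does⁺ (yes _) _  = _
T-does⁺ (no ¬p) p  = ¬p p

T-does⁻ : ∀ {P : Set} (P? : Dec P) → T (does P?) → P
T-does⁻ (yes p) _ = p

T-injective : ∀ {a b} → T a ⇔ T b → a ≡ b
T-injective {a} {b} Ta⇔Tb = does-⇔ Ta⇔Tb (T? a) (T? b)

-- Divisibility and the Möbius function

quotient≥1 : ∀ {n t e} → 1 ≤ n → n ≡ t ℕ.* e → 1 ≤ t
quotient≥1 {t = zero}  () refl
quotient≥1 {t = suc _} _  _ = s≤s z≤n

m≤m*n : ∀ {m n} → 1 ≤ n → m ≤ m ℕ.* n
m≤m*n {m} {n} 1≤n = ℕP.m≤m*n m n {{ℕ.>-nonZero 1≤n}}

m≤n*m : ∀ {m n} → 1 ≤ n → m ≤ n ℕ.* m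
m≤n*m {m} {n} 1≤n = ℕP.m≤n*m m n {{ℕ.>-nonZero 1≤n}}

∣⇒≤′ : ∀ {a b} → a ∣ b → 1 ≤ b → a ≤ b
∣⇒≤′ {b = suc b} a∣b _ = ∣⇒≤ a∣b

prime≥1 : ∀ {p} → Prime p → 1 ≤ p
prime≥1 {p} p-prime = ℕ.>-nonZero⁻¹ p {{prime⇒nonZero p-prime}}

prime≢1 : ∀ {p} → Prime p → ¬ p ≡ 1
prime≢1 p-prime refl = ¬prime[1] p-prime

prime∣prime⇒≡ : ∀ {p q} → Prime p → Prime q → p ∣ q → p ≡ q
prime∣prime⇒≡ p-prime q-prime p∣q with prime⇒irreducible q-prime p∣q
... | inj₁ p≡1 = ⊥-elim (prime≢1 p-prime p≡1)
... | inj₂ p≡q = p≡q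

prime∣prime*⇒∣ : ∀ {q p y} → Prime q → Prime p → ¬ q ≡ p → q ∣ p ℕ.* y → q ∣ y
prime∣prime*⇒∣ {q} {p} {y} q-prime p-prime q≢p q∣py with euclidsLemma p y q-prime q∣py
... | inj₁ q∣p = ⊥-elim (q≢p (prime∣prime⇒≡ q-prime p-prime q∣p))
... | inj₂ q∣y = q∣y

prime∤⇒coprime : ∀ {p e} → Prime p → ¬ p ∣ e → Coprime e p
prime∤⇒coprime p-prime p∤e (d∣e , d∣p) with prime⇒irreducible p-prime d∣p
... | inj₁ d≡1 = d≡1
... | inj₂ refl = ⊥-elim (p∤e d∣e)

isPrimeDivisor? : (n x : ℕ) → Dec (Prime x × x ∣ n)
isPrimeDivisor? n x = prime? x ×-dec (x ∣? n)

∈-primeDivisors⁺ : ∀ {n q} → 1 ≤ n → Prime q → q ∣ n → q ∈ primeDivisors n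
∈-primeDivisors⁺ {n} 1≤n q-prime q∣n =
  ∈-filter⁺ (isPrimeDivisor? n) (∈-upTo⁺ (s≤s (∣⇒≤′ q∣n 1≤n))) (q-prime , q∣n)

∈-primeDivisors⁻ : ∀ {n q} → q ∈ primeDivisors n → Prime q × q ∣ n
∈-primeDivisors⁻ {n} q∈ = proj₂ (∈-filter⁻ (isPrimeDivisor? n) {xs = List.upTo (suc n)} q∈)

squareful : ℕ → Bool
squareful n = any (λ q → does ((q ℕ.* q) ∣? n)) (primeDivisors n)

squareful⇔ : ∀ {n} → 1 ≤ n → T (squareful n) ⇔ ∃ λ q → Prime q × q ℕ.* q ∣ n
squareful⇔ {n} 1≤n = mk⇔ to from
  where
  to : T (squareful n) → ∃ λ q → Prime q × q ℕ.* q ∣ n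
  to sq with find (any⁻ _ (primeDivisors n) sq)
  ... | q , q∈ , q²∣n = q , proj₁ (∈-primeDivisors⁻ {n} q∈) , T-does⁻ (q ℕ.* q ∣? n) q²∣n
  from : (∃ λ q → Prime q × q ℕ.* q ∣ n) → T (squareful n)
  from (q , q-prime , q²∣n) =
    any⁺ _ (lose (∈-primeDivisors⁺ 1≤n q-prime (∣-trans (m∣m*n q) q²∣n)) (T-does⁺ (q ℕ.* q ∣? n) q²∣n))

square∣prime*⇒square∣ : ∀ {p q y} → Prime p → ¬ p ∣ y → Prime q → q ℕ.* q ∣ p ℕ.* y → q ℕ.* q ∣ y
square∣prime*⇒square∣ {p} {q} {y} p-prime p∤y q-prime q²∣py =
  coprime-divisor (prime∤⇒coprime p-prime p∤q²) q²∣py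
  where
  p∤q² : ¬ p ∣ q ℕ.* q
  p∤q² p∣q² = p∤y (*-cancelˡ-∣ p {{prime⇒nonZero p-prime}} (subst (λ r → r ℕ.* r ∣ p ℕ.* y) (sym p≡q) q²∣py))
    where p≡q = prime∣prime⇒≡ p-prime q-prime (reduce (euclidsLemma q q p-prime p∣q²))

squareful-prime* : ∀ {p y} → Prime p → ¬ p ∣ y → 1 ≤ y → squareful (p ℕ.* y) ≡ squareful y
squareful-prime* {p} {y} p-prime p∤y 1≤y = T-injective (mk⇔
  (λ sq → let (q , q-prime , q²∣py) = Equivalence.to (squareful⇔ 1≤py) sq
          in Equivalence.from (squareful⇔ 1≤y) (q , q-prime , square∣prime*⇒square∣ p-prime p∤y q-prime q²∣py))
  (λ sq → let (q , q-prime , q²∣y) = Equivalence.to (squareful⇔ 1≤y) sq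
          in Equivalence.from (squareful⇔ 1≤py) (q , q-prime , ∣-trans q²∣y (n∣m*n p))))
  where
  1≤py = ℕP.≤-trans 1≤y (m≤n*m (prime≥1 p-prime))

length-primeDivisors≡∑ : ∀ n → + length (primeDivisors n) ≡ ∑[ x ∈ range 0 (suc n) ] when (does (isPrimeDivisor? n x)) 1ℤ
length-primeDivisors≡∑ n =
  trans (length-filter≡∑ (isPrimeDivisor? n) (List.upTo (suc n)))
        (cong (λ xs → ∑[ x ∈ xs ] when (does (isPrimeDivisor? n x)) 1ℤ) (upTo≡range (suc n)))

isPrimeDivisor-prime* : ∀ {p y} → Prime p → ¬ p ∣ y → ∀ x →
  when (does (isPrimeDivisor? (p ℕ.* y) x)) 1ℤ ≡ when (does (isPrimeDivisor? y x)) 1ℤ + when (x ≡ᵇ p) 1ℤ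
isPrimeDivisor-prime* {p} {y} p-prime p∤y x with x ≟ p
... | yes refl
  rewrite ≡ᵇ-true {x} refl
        | dec-true (isPrimeDivisor? (p ℕ.* y) p) (p-prime , m∣m*n y)
        | dec-false (isPrimeDivisor? y p) (λ pd → p∤y (proj₂ pd)) = refl
... | no x≢p rewrite ≡ᵇ-false x≢p = trans (cong (λ b → when b 1ℤ) same) (sym (ℤP.+-identityʳ _))
  where
  same = T-injective (mk⇔
    (λ t → let (x-prime , x∣py) = T-does⁻ (isPrimeDivisor? (p ℕ.* y) x) t
           in T-does⁺ (isPrimeDivisor? y x) (x-prime , prime∣prime*⇒∣ x-prime p-prime x≢p x∣py))
    (λ t → let (x-prime , x∣y) = T-does⁻ (isPrimeDivisor? y x) t
           in T-does⁺ (isPrimeDivisor? (p ℕ.* y) x) (x-prime , ∣-trans x∣y (n∣m*n p))))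

length-primeDivisors-prime* : ∀ {p y} → Prime p → ¬ p ∣ y → 1 ≤ y →
                              length (primeDivisors (p ℕ.* y)) ≡ suc (length (primeDivisors y))
length-primeDivisors-prime* {p} {y} p-prime p∤y 1≤y = ℤP.+-injective (begin
  + length (primeDivisors N)                                   ≡⟨ length-primeDivisors≡∑ N ⟩
  ∑[ x ∈ range 0 (suc N) ] when (does (isPrimeDivisor? N x)) 1ℤ  ≡⟨ ∑-cong (range 0 (suc N)) (isPrimeDivisor-prime* p-prime p∤y) ⟩
  ∑[ x ∈ range 0 (suc N) ] (χ x + when (x ≡ᵇ p) 1ℤ)             ≡⟨ ∑-+ (range 0 (suc N)) χ (λ x → when (x ≡ᵇ p) 1ℤ) ⟩
  ∑ (range 0 (suc N)) χ + ∑[ x ∈ range 0 (suc N) ] when (x ≡ᵇ p) 1ℤ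
    ≡⟨ cong₂ _+_ (∑-range-extend 0 (suc y) (suc N) χ (s≤s y≤N) χ-vanishes)
                 (∑-range-indicator 0 (suc N) p (λ _ → 1ℤ) z≤n (s≤s p≤N)) ⟩
  ∑ (range 0 (suc y)) χ + 1ℤ                                    ≡⟨ cong (_+ 1ℤ) (sym (length-primeDivisors≡∑ y)) ⟩
  + length (primeDivisors y) + 1ℤ                              ≡⟨ cong +_ (ℕP.+-comm (length (primeDivisors y)) 1) ⟩
  + suc (length (primeDivisors y))                             ∎)
  where
  open ≡-Reasoning
  N = p ℕ.* y
  χ : ℕ → ℤ
  χ x = when (does (isPrimeDivisor? y x)) 1ℤ
  y≤N = m≤n*m (prime≥1 p-prime)
  p≤N = m≤m*n 1≤y
  χ-vanishes : ∀ x → suc y ≤ x → χ x ≡ 0ℤ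
  χ-vanishes x y<x rewrite dec-false (isPrimeDivisor? y x) (λ pd → ℕP.<⇒≱ y<x (∣⇒≤′ (proj₂ pd) 1≤y)) = refl

μ-prime*-∣ : ∀ {p y} → Prime p → p ∣ y → 1 ≤ y → μ (p ℕ.* y) ≡ 0ℤ
μ-prime*-∣ {p} {y} p-prime p∣y 1≤y = cong (λ b → if b then + 0 else (- 1ℤ) ℤ.^ length (primeDivisors (p ℕ.* y))) squareful-py
  where
  1≤py = ℕP.≤-trans 1≤y (m≤n*m (prime≥1 p-prime))
  squareful-py : squareful (p ℕ.* y) ≡ true
  squareful-py = Equivalence.to BoolP.T-≡ (Equivalence.from (squareful⇔ 1≤py) (p , p-prime , *-monoʳ-∣ p p∣y))

μ-prime*-∤ : ∀ {p y} → Prime p → ¬ p ∣ y → 1 ≤ y → μ (p ℕ.* y) ≡ - μ y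
μ-prime*-∤ p-prime p∤y 1≤y = flip-sign (squareful-prime* p-prime p∤y 1≤y) (length-primeDivisors-prime* p-prime p∤y 1≤y)
  where
  flip-sign : ∀ {b c k l} → b ≡ c → k ≡ suc l →
              (if b then + 0 else (- 1ℤ) ℤ.^ k) ≡ - (if c then + 0 else (- 1ℤ) ℤ.^ l)
  flip-sign {true}  refl _    = refl
  flip-sign {false} refl refl = ℤP.-1*i≡-i _

-- Divisor sums and Möbius inversion

divSum : ℕ → (ℕ → ℕ → ℤ) → ℤ
divSum n g = ∑[ d ∈ range 1 n ] ∑[ e ∈ range 1 n ] when (d ℕ.* e ≡ᵇ n) (g d e)

divisorSum≡divSum : ∀ n g → divisorSum n g ≡ divSum n g
divisorSum≡divSum n g = begin
  divisorSum n g
    ≡⟨ foldr-concatMap _ (map suc (List.upTo n)) ⟩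
  ∑[ d ∈ map suc (List.upTo n) ] List.foldr _+_ 0ℤ (List.concatMap (singletonIf d) (map suc (List.upTo n)))
    ≡⟨ ∑-cong (map suc (List.upTo n)) (λ d → trans (foldr-concatMap _ (map suc (List.upTo n)))
                                                 (∑-cong (map suc (List.upTo n)) (λ e → foldr-singletonIf _ (g d e)))) ⟩
  ∑[ d ∈ map suc (List.upTo n) ] ∑[ e ∈ map suc (List.upTo n) ] when (d ℕ.* e ≡ᵇ n) (g d e)
    ≡⟨ cong (λ xs → ∑[ d ∈ xs ] ∑[ e ∈ xs ] when (d ℕ.* e ≡ᵇ n) (g d e)) (map-suc-upTo≡range n) ⟩
  divSum n g ∎
  where
  open ≡-Reasoning
  singletonIf : ℕ → ℕ → List ℤ
  singletonIf d e = if d ℕ.* e ≡ᵇ n then g d e ∷ [] else []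
  foldr-++ : ∀ xs ys → List.foldr _+_ 0ℤ (xs ++ ys) ≡ List.foldr _+_ 0ℤ xs + List.foldr _+_ 0ℤ ys
  foldr-++ []       ys = sym (ℤP.+-identityˡ _)
  foldr-++ (x ∷ xs) ys = trans (cong (λ s → x + s) (foldr-++ xs ys)) (sym (ℤP.+-assoc x _ _))
  foldr-concatMap : ∀ (F : ℕ → List ℤ) xs → List.foldr _+_ 0ℤ (List.concatMap F xs) ≡ ∑[ x ∈ xs ] List.foldr _+_ 0ℤ (F x)
  foldr-concatMap F []       = refl
  foldr-concatMap F (x ∷ xs) = trans (foldr-++ (F x) _) (cong (λ s → List.foldr _+_ 0ℤ (F x) + s) (foldr-concatMap F xs))
  foldr-singletonIf : ∀ b v → List.foldr _+_ 0ℤ (if b then v ∷ [] else []) ≡ when b v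
  foldr-singletonIf true  v = ℤP.+-identityʳ v
  foldr-singletonIf false v = refl

divSum-cong : ∀ n {f g : ℕ → ℕ → ℤ} → (∀ d e → 1 ≤ d → f d e ≡ g d e) → divSum n f ≡ divSum n g
divSum-cong n f≗g = ∑-cong-∈ (range 1 n) (λ d d∈ → ∑-cong (range 1 n) (λ e →
  cong (when (d ℕ.* e ≡ᵇ n)) (f≗g d e (proj₁ (∈-range1⁻ d∈)))))

divSum-- : ∀ n (f g : ℕ → ℕ → ℤ) → divSum n (λ d e → f d e - g d e) ≡ divSum n f - divSum n g
divSum-- n f g = trans (∑-cong (range 1 n) (λ d → trans (∑-cong (range 1 n) (λ e → when-- (d ℕ.* e ≡ᵇ n) (f d e) (g d e)))
                                                       (∑-- (range 1 n) _ _)))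
                       (∑-- (range 1 n) _ _)

divSum-*ˡ : ∀ n c (f : ℕ → ℕ → ℤ) → divSum n (λ d e → c * f d e) ≡ c * divSum n f
divSum-*ˡ n c f = trans (∑-cong (range 1 n) (λ d → trans (∑-cong (range 1 n) (λ e → when-*ˡ (d ℕ.* e ≡ᵇ n) c (f d e)))
                                                         (∑-*ˡ (range 1 n) c _)))
                        (∑-*ˡ (range 1 n) c _)

∑-cofactor : ∀ n e X → 1 ≤ e → 1 ≤ n → ∑[ d ∈ range 1 n ] when (d ℕ.* e ≡ᵇ n) X ≡ when (does (e ∣? n)) X
∑-cofactor n e X 1≤e 1≤n with e ∣? n
... | no e∤n = ∑-zero (range 1 n) _ (λ d _ → cong (λ b → when b X) (≡ᵇ-false (λ de≡n → e∤n (divides d (sym de≡n)))))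
... | yes (divides t n≡te) = trans
  (∑-cong (range 1 n) (λ d → cong (λ b → when b X) (≡ᵇ-cong {d ℕ.* e} {n} {d} {t}
     (mk⇔ (λ de≡n → ℕP.*-cancelʳ-≡ d t e {{ℕ.>-nonZero 1≤e}} (trans de≡n n≡te)) (λ { refl → sym n≡te })))))
  (∑-range-indicator 1 n t (λ _ → X) (quotient≥1 1≤n n≡te) (s≤s (subst (t ≤_) (sym n≡te) (m≤m*n 1≤e))))

∑μ-divisors : ℕ → ℤ
∑μ-divisors q = ∑[ e ∈ range 1 q ] when (does (e ∣? q)) (μ e)

divSum-μ≡∑μ-divisors : ∀ q → 1 ≤ q → divSum q (λ _ e → μ e) ≡ ∑μ-divisors q
divSum-μ≡∑μ-divisors q 1≤q = trans (∑-comm (range 1 q) (range 1 q) (λ d e → when (d ℕ.* e ≡ᵇ q) (μ e)))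
  (∑-cong-∈ (range 1 q) (λ e e∈ → ∑-cofactor q e (μ e) (proj₁ (∈-range1⁻ e∈)) 1≤q))

∑-multiples : ∀ p r (h : ℕ → ℤ) → 1 ≤ p →
              ∑[ e ∈ range 1 (p ℕ.* r) ] when (does (p ∣? e)) (h e) ≡ ∑[ y ∈ range 1 r ] h (p ℕ.* y)
∑-multiples p r h 1≤p = begin
  ∑[ e ∈ range 1 (p ℕ.* r) ] when (does (p ∣? e)) (h e)
    ≡⟨ ∑-cong-∈ (range 1 (p ℕ.* r)) as-indicator ⟩
  ∑[ e ∈ range 1 (p ℕ.* r) ] ∑[ y ∈ range 1 r ] when (e ≡ᵇ p ℕ.* y) (h e)
    ≡⟨ ∑-comm (range 1 (p ℕ.* r)) (range 1 r) (λ e y → when (e ≡ᵇ p ℕ.* y) (h e)) ⟩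
  ∑[ y ∈ range 1 r ] ∑[ e ∈ range 1 (p ℕ.* r) ] when (e ≡ᵇ p ℕ.* y) (h e)
    ≡⟨ ∑-cong-∈ (range 1 r) (λ y y∈ → let (1≤y , y≤r) = ∈-range1⁻ y∈ in
         ∑-range-indicator 1 (p ℕ.* r) (p ℕ.* y) h (ℕP.*-mono-≤ 1≤p 1≤y) (s≤s (ℕP.*-monoʳ-≤ p y≤r))) ⟩
  ∑[ y ∈ range 1 r ] h (p ℕ.* y) ∎
  where
  open ≡-Reasoning
  instance p≢0 = ℕ.>-nonZero 1≤p
  as-indicator : ∀ e → e ∈ range 1 (p ℕ.* r) →
                 when (does (p ∣? e)) (h e) ≡ ∑[ y ∈ range 1 r ] when (e ≡ᵇ p ℕ.* y) (h e)
  as-indicator e e∈ with p ∣? e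
  ... | no p∤e = sym (∑-zero (range 1 r) _ (λ y _ → cong (λ b → when b (h e))
        (≡ᵇ-false (λ e≡py → p∤e (divides y (trans e≡py (ℕP.*-comm p y)))))))
  ... | yes (divides t e≡tp) = sym (trans
        (∑-cong (range 1 r) (λ y → cong (λ b → when b (h e)) (≡ᵇ-cong {e} {p ℕ.* y} {y} {t}
           (mk⇔ (λ e≡py → ℕP.*-cancelʳ-≡ y t p (trans (ℕP.*-comm y p) (trans (sym e≡py) e≡tp)))
                (λ { refl → trans e≡tp (ℕP.*-comm t p) })))))
        (∑-range-indicator 1 r t (λ _ → h e) (quotient≥1 1≤e e≡tp) (s≤s t≤r)))
    where
    1≤e = proj₁ (∈-range1⁻ e∈)
    t≤r : t ≤ r
    t≤r = ℕP.*-cancelʳ-≤ t r p (subst (_≤ r ℕ.* p) e≡tp (subst (e ≤_) (ℕP.*-comm p r) (proj₂ (∈-range1⁻ e∈))))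

-- The divisors p y of q = p r with p ∣ y contribute μ (p y) = 0; those with p ∤ y contribute
-- μ (p y) = − μ y and cancel the divisors y of r coprime to p, which are exactly the divisors of q coprime to p.
module _ {p r : ℕ} (p-prime : Prime p) (1≤r : 1 ≤ r) where

  private
    q = p ℕ.* r
    instance p≢0 = prime⇒nonZero p-prime

  ∑μ-divisors-multiple : ∑[ e ∈ range 1 q ] when (does (p ∣? e)) (when (does (e ∣? q)) (μ e))
                       ≡ ∑[ y ∈ range 1 r ] when (does (y ∣? r)) (when (not (does (p ∣? y))) (- μ y))
  ∑μ-divisors-multiple =
    trans (∑-multiples p r (λ e → when (does (e ∣? q)) (μ e)) (prime≥1 p-prime))
          (∑-cong-∈ (range 1 r) (λ y y∈ → cong₂ when (divisor-cancel y) (μ-prime* y (proj₁ (∈-range1⁻ y∈)))))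
    where
    divisor-cancel : ∀ y → does ((p ℕ.* y) ∣? q) ≡ does (y ∣? r)
    divisor-cancel y = does-⇔ (mk⇔ (*-cancelˡ-∣ p) (*-monoʳ-∣ p)) ((p ℕ.* y) ∣? q) (y ∣? r)
    μ-prime* : ∀ y → 1 ≤ y → μ (p ℕ.* y) ≡ when (not (does (p ∣? y))) (- μ y)
    μ-prime* y 1≤y with p ∣? y
    ... | yes p∣y = μ-prime*-∣ p-prime p∣y 1≤y
    ... | no  p∤y = μ-prime*-∤ p-prime p∤y 1≤y

  ∑μ-divisors-coprime : ∑[ e ∈ range 1 q ] when (not (does (p ∣? e))) (when (does (e ∣? q)) (μ e))
                      ≡ ∑[ y ∈ range 1 r ] when (not (does (p ∣? y))) (when (does (y ∣? r)) (μ y))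
  ∑μ-divisors-coprime =
    trans (∑-cong (range 1 q) coprime-divisor-cancel)
          (∑-range-extend 1 r q _ (m≤n*m (prime≥1 p-prime)) beyond-r)
    where
    coprime-divisor-cancel : ∀ e → when (not (does (p ∣? e))) (when (does (e ∣? q)) (μ e))
                                 ≡ when (not (does (p ∣? e))) (when (does (e ∣? r)) (μ e))
    coprime-divisor-cancel e with p ∣? e
    ... | yes _   = refl
    ... | no  p∤e = cong (λ b → when b (μ e)) (does-⇔
          (mk⇔ (coprime-divisor (prime∤⇒coprime p-prime p∤e)) (λ e∣r → ∣-trans e∣r (n∣m*n p)))
          (e ∣? q) (e ∣? r))
    beyond-r : ∀ x → 1 ℕ.+ r ≤ x → when (not (does (p ∣? x))) (when (does (x ∣? r)) (μ x)) ≡ 0ℤ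
    beyond-r x r<x rewrite dec-false (x ∣? r) (λ x∣r → ℕP.<⇒≱ r<x (∣⇒≤′ x∣r 1≤r)) = when-zero _

  ∑μ-divisors-prime* : ∑μ-divisors q ≡ 0ℤ
  ∑μ-divisors-prime* = begin
    ∑μ-divisors q
      ≡⟨ ∑-cong (range 1 q) (λ e → when-split (does (p ∣? e)) (does (e ∣? q)) (μ e)) ⟩
    ∑[ e ∈ range 1 q ] (when (does (p ∣? e)) (χ e) + when (not (does (p ∣? e))) (χ e))
      ≡⟨ ∑-+ (range 1 q) _ _ ⟩
    ∑[ e ∈ range 1 q ] when (does (p ∣? e)) (χ e) + ∑[ e ∈ range 1 q ] when (not (does (p ∣? e))) (χ e)
      ≡⟨ cong₂ _+_ ∑μ-divisors-multiple ∑μ-divisors-coprime ⟩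
    ∑ (range 1 r) A + ∑ (range 1 r) B
      ≡⟨ sym (∑-+ (range 1 r) A B) ⟩
    ∑[ y ∈ range 1 r ] (A y + B y)
      ≡⟨ ∑-zero (range 1 r) _ (λ y _ → cancel (does (y ∣? r)) (does (p ∣? y)) (μ y)) ⟩
    0ℤ ∎
    where
    open ≡-Reasoning
    χ : ℕ → ℤ
    χ e = when (does (e ∣? q)) (μ e)
    A B : ℕ → ℤ
    A y = when (does (y ∣? r)) (when (not (does (p ∣? y))) (- μ y))
    B y = when (not (does (p ∣? y))) (when (does (y ∣? r)) (μ y))
    cancel : ∀ a b v → when a (when (not b) (- v)) + when (not b) (when a v) ≡ 0ℤ
    cancel true  true  v = refl
    cancel true  false v = ℤP.+-inverseˡ v
    cancel false true  v = refl
    cancel false false v = refl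

∑μ-divisors≡[1] : ∀ q → 1 ≤ q → ∑μ-divisors q ≡ when (q ≡ᵇ 1) 1ℤ
∑μ-divisors≡[1] 1                  _ = refl
∑μ-divisors≡[1] q@(suc (suc _)) _ with factorise q
... | record { factors = [] ; isFactorisation = () }
... | record { factors = p ∷ ps ; isFactorisation = q≡p*r ; factorsPrime = p-prime ∷ _ } =
  trans (cong ∑μ-divisors q≡p*r) (∑μ-divisors-prime* p-prime (quotient≥1 {t = product ps} (s≤s z≤n) (trans q≡p*r (ℕP.*-comm p _))))

divSum-μ : ∀ q → 1 ≤ q → divSum q (λ _ e → μ e) ≡ when (q ≡ᵇ 1) 1ℤ
divSum-μ q 1≤q = trans (divSum-μ≡∑μ-divisors q 1≤q) (∑μ-divisors≡[1] q 1≤q)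

divSum-restrict : ∀ n t (X : ℕ → ℕ → ℤ) → 1 ≤ t → t ≤ n →
  ∑[ a ∈ range 1 n ] ∑[ b ∈ range 1 n ] when (a ℕ.* b ≡ᵇ t) (X a b) ≡ divSum t X
divSum-restrict n t X 1≤t t≤n =
  trans (∑-cong-∈ (range 1 n) (λ a a∈ → ∑-range-extend 1 t n _ t≤n (b-beyond a (proj₁ (∈-range1⁻ a∈)))))
        (∑-range-extend 1 t n _ t≤n a-beyond)
  where
  b-beyond : ∀ a → 1 ≤ a → ∀ b → 1 ℕ.+ t ≤ b → when (a ℕ.* b ≡ᵇ t) (X a b) ≡ 0ℤ
  b-beyond a 1≤a b t<b rewrite ≡ᵇ-false {a ℕ.* b} {t} (λ ab≡t → ℕP.<⇒≱ t<b
    (subst (b ≤_) ab≡t (m≤n*m 1≤a))) = refl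
  a-beyond : ∀ a → 1 ℕ.+ t ≤ a → ∑[ b ∈ range 1 t ] when (a ℕ.* b ≡ᵇ t) (X a b) ≡ 0ℤ
  a-beyond a t<a = ∑-zero (range 1 t) _ (λ b b∈ → cong (λ c → when c (X a b)) (≡ᵇ-false {a ℕ.* b} {t}
    (λ ab≡t → ℕP.<⇒≱ t<a (subst (a ≤_) ab≡t (m≤m*n (proj₁ (∈-range1⁻ b∈)))))))

∑-μ-cofactor : ∀ n c → 1 ≤ c → c ≤ n →
  ∑[ c′ ∈ range 1 n ] ∑[ e ∈ range 1 n ] when (c ℕ.* c′ ℕ.* e ≡ᵇ n) (μ e) ≡ when (c ≡ᵇ n) 1ℤ
∑-μ-cofactor n c 1≤c c≤n with c ∣? n
... | no c∤n = trans
  (∑-zero (range 1 n) _ (λ c′ _ → ∑-zero (range 1 n) _ (λ e _ → cong (λ b → when b (μ e)) (≡ᵇ-false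
     (λ cc′e≡n → c∤n (divides (c′ ℕ.* e) (trans (sym cc′e≡n) (trans (ℕP.*-assoc c c′ e) (ℕP.*-comm c (c′ ℕ.* e))))))))))
  (sym (cong (λ b → when b 1ℤ) (≡ᵇ-false {c} {n} (λ { refl → c∤n ∣-refl }))))
... | yes (divides t n≡tc) = begin
  ∑[ c′ ∈ range 1 n ] ∑[ e ∈ range 1 n ] when (c ℕ.* c′ ℕ.* e ≡ᵇ n) (μ e)
    ≡⟨ ∑-cong (range 1 n) (λ c′ → ∑-cong (range 1 n) (λ e → cong (λ b → when b (μ e)) (cancel-c c′ e))) ⟩
  ∑[ c′ ∈ range 1 n ] ∑[ e ∈ range 1 n ] when (c′ ℕ.* e ≡ᵇ t) (μ e)
    ≡⟨ divSum-restrict n t (λ _ e → μ e) 1≤t t≤n ⟩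
  divSum t (λ _ e → μ e)
    ≡⟨ divSum-μ t 1≤t ⟩
  when (t ≡ᵇ 1) 1ℤ
    ≡⟨ cong (λ b → when b 1ℤ) (≡ᵇ-cong {t} {1} {c} {n}
         (mk⇔ (λ { refl → sym (trans n≡tc (ℕP.*-identityˡ c)) })
              (λ { refl → ℕP.*-cancelʳ-≡ t 1 c (trans (sym n≡tc) (sym (ℕP.*-identityˡ c))) }))) ⟩
  when (c ≡ᵇ n) 1ℤ ∎
  where
  open ≡-Reasoning
  instance c≢0 = ℕ.>-nonZero 1≤c
  1≤t = quotient≥1 (ℕP.≤-trans 1≤c c≤n) n≡tc
  t≤n = subst (t ≤_) (sym n≡tc) (m≤m*n 1≤c)
  cancel-c : ∀ c′ e → (c ℕ.* c′ ℕ.* e ≡ᵇ n) ≡ (c′ ℕ.* e ≡ᵇ t)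
  cancel-c c′ e = ≡ᵇ-cong {c ℕ.* c′ ℕ.* e} {n} {c′ ℕ.* e} {t} (mk⇔
    (λ eq → ℕP.*-cancelʳ-≡ (c′ ℕ.* e) t c (trans (ℕP.*-comm (c′ ℕ.* e) c) (trans (sym (ℕP.*-assoc c c′ e)) (trans eq n≡tc))))
    (λ eq → trans (ℕP.*-assoc c c′ e) (trans (cong (c ℕ.*_) eq) (trans (ℕP.*-comm c t) (sym n≡tc)))))

∑-reorder₄ : {A : Set} (R : List A) (f : A → A → A → A → ℤ) →
  ∑[ d ∈ R ] ∑[ e ∈ R ] ∑[ c ∈ R ] ∑[ c′ ∈ R ] f d e c c′ ≡ ∑[ c ∈ R ] ∑[ c′ ∈ R ] ∑[ e ∈ R ] ∑[ d ∈ R ] f d e c c′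
∑-reorder₄ R f = begin
  ∑[ d ∈ R ] ∑[ e ∈ R ] ∑[ c ∈ R ] ∑[ c′ ∈ R ] f d e c c′ ≡⟨ ∑-cong R (λ d → ∑-comm R R (λ e c → ∑[ c′ ∈ R ] f d e c c′)) ⟩
  ∑[ d ∈ R ] ∑[ c ∈ R ] ∑[ e ∈ R ] ∑[ c′ ∈ R ] f d e c c′ ≡⟨ ∑-cong R (λ d → ∑-cong R (λ c → ∑-comm R R (λ e c′ → f d e c c′))) ⟩
  ∑[ d ∈ R ] ∑[ c ∈ R ] ∑[ c′ ∈ R ] ∑[ e ∈ R ] f d e c c′ ≡⟨ ∑-comm R R (λ d c → ∑[ c′ ∈ R ] ∑[ e ∈ R ] f d e c c′) ⟩
  ∑[ c ∈ R ] ∑[ d ∈ R ] ∑[ c′ ∈ R ] ∑[ e ∈ R ] f d e c c′ ≡⟨ ∑-cong R (λ c → ∑-comm R R (λ d c′ → ∑[ e ∈ R ] f d e c c′)) ⟩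
  ∑[ c ∈ R ] ∑[ c′ ∈ R ] ∑[ d ∈ R ] ∑[ e ∈ R ] f d e c c′ ≡⟨ ∑-cong R (λ c → ∑-cong R (λ c′ → ∑-comm R R (λ d e → f d e c c′))) ⟩
  ∑[ c ∈ R ] ∑[ c′ ∈ R ] ∑[ e ∈ R ] ∑[ d ∈ R ] f d e c c′ ∎
  where open ≡-Reasoning

∑-middle-divisor : ∀ n c c′ e v → 1 ≤ c → 1 ≤ c′ → 1 ≤ e →
  ∑[ d ∈ range 1 n ] when (d ℕ.* e ≡ᵇ n) (when (c ℕ.* c′ ≡ᵇ d) v) ≡ when (c ℕ.* c′ ℕ.* e ≡ᵇ n) v
∑-middle-divisor n c c′ e v 1≤c 1≤c′ 1≤e = trans
  (∑-cong (range 1 n) (λ d → trans (when-comm (d ℕ.* e ≡ᵇ n) (c ℕ.* c′ ≡ᵇ d) v)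
                                   (cong (λ b → when b (when (d ℕ.* e ≡ᵇ n) v)) (≡ᵇ-sym (c ℕ.* c′) d))))
  select
  where
  cc′ = c ℕ.* c′
  select : ∑[ d ∈ range 1 n ] when (d ≡ᵇ cc′) (when (d ℕ.* e ≡ᵇ n) v) ≡ when (cc′ ℕ.* e ≡ᵇ n) v
  select with cc′ ≤? n
  ... | yes cc′≤n = ∑-range-indicator 1 n cc′ (λ d → when (d ℕ.* e ≡ᵇ n) v) (ℕP.*-mono-≤ 1≤c 1≤c′) (s≤s cc′≤n)
  ... | no  cc′≰n = trans (∑-indicator-∉ (range 1 n) cc′ _ (λ cc′∈ → cc′≰n (proj₂ (∈-range1⁻ cc′∈))))
        (sym (cong (λ b → when b v) (≡ᵇ-false {cc′ ℕ.* e} {n} (λ cc′e≡n → cc′≰n (subst (cc′ ≤_) cc′e≡n (m≤m*n 1≤e))))))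

-- After expanding F d = ∑_{c c′ = d} G c, the coefficient of G c is ∑_{c c′ e = n} μ e = [c = n].
möbius-inversion : (F G : ℕ → ℤ) → (∀ n → 1 ≤ n → F n ≡ divSum n (λ d _ → G d)) →
                   ∀ n → 1 ≤ n → divSum n (λ d e → μ e * F d) ≡ G n
möbius-inversion F G F≡∑G n 1≤n = begin
  divSum n (λ d e → μ e * F d)
    ≡⟨ ∑-cong-∈ R (λ d d∈ → ∑-cong R (λ e → expand-F d e (∈-range1⁻ d∈))) ⟩
  ∑[ d ∈ R ] ∑[ e ∈ R ] ∑[ c ∈ R ] ∑[ c′ ∈ R ] term d e c c′
    ≡⟨ ∑-reorder₄ R term ⟩
  ∑[ c ∈ R ] ∑[ c′ ∈ R ] ∑[ e ∈ R ] ∑[ d ∈ R ] term d e c c′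
    ≡⟨ ∑-cong-∈ R (λ c c∈ → ∑-cong-∈ R (λ c′ c′∈ → ∑-cong-∈ R (λ e e∈ →
         ∑-middle-divisor n c c′ e (μ e * G c) (proj₁ (∈-range1⁻ c∈)) (proj₁ (∈-range1⁻ c′∈)) (proj₁ (∈-range1⁻ e∈))))) ⟩
  ∑[ c ∈ R ] ∑[ c′ ∈ R ] ∑[ e ∈ R ] when (c ℕ.* c′ ℕ.* e ≡ᵇ n) (μ e * G c)
    ≡⟨ ∑-cong R factor-G ⟩
  ∑[ c ∈ R ] (G c * ∑[ c′ ∈ R ] ∑[ e ∈ R ] when (c ℕ.* c′ ℕ.* e ≡ᵇ n) (μ e))
    ≡⟨ ∑-cong-∈ R (λ c c∈ → let (1≤c , c≤n) = ∈-range1⁻ c∈ in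
         trans (cong (G c *_) (∑-μ-cofactor n c 1≤c c≤n)) (when-·1 (c ≡ᵇ n) (G c))) ⟩
  ∑[ c ∈ R ] when (c ≡ᵇ n) (G c)
    ≡⟨ ∑-range-indicator 1 n n G 1≤n (s≤s ℕP.≤-refl) ⟩
  G n ∎
  where
  open ≡-Reasoning
  R = range 1 n
  term : ℕ → ℕ → ℕ → ℕ → ℤ
  term d e c c′ = when (d ℕ.* e ≡ᵇ n) (when (c ℕ.* c′ ≡ᵇ d) (μ e * G c))
  expand-F : ∀ d e → 1 ≤ d × d ≤ n →
             when (d ℕ.* e ≡ᵇ n) (μ e * F d) ≡ ∑[ c ∈ R ] ∑[ c′ ∈ R ] term d e c c′
  expand-F d e (1≤d , d≤n) = begin
    when (d ℕ.* e ≡ᵇ n) (μ e * F d)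
      ≡⟨ cong (λ z → when (d ℕ.* e ≡ᵇ n) (μ e * z)) (trans (F≡∑G d 1≤d) (sym (divSum-restrict n d (λ c _ → G c) 1≤d d≤n))) ⟩
    when (d ℕ.* e ≡ᵇ n) (μ e * ∑[ c ∈ R ] ∑[ c′ ∈ R ] when (c ℕ.* c′ ≡ᵇ d) (G c))
      ≡⟨ cong (when (d ℕ.* e ≡ᵇ n)) (sym (trans (∑-cong R (λ c → ∑-*ˡ R (μ e) _)) (∑-*ˡ R (μ e) _))) ⟩
    when (d ℕ.* e ≡ᵇ n) (∑[ c ∈ R ] ∑[ c′ ∈ R ] (μ e * when (c ℕ.* c′ ≡ᵇ d) (G c)))
      ≡⟨ sym (trans (∑-cong R (λ c → ∑-when R (d ℕ.* e ≡ᵇ n) _)) (∑-when R _ _)) ⟩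
    ∑[ c ∈ R ] ∑[ c′ ∈ R ] when (d ℕ.* e ≡ᵇ n) (μ e * when (c ℕ.* c′ ≡ᵇ d) (G c))
      ≡⟨ ∑-cong R (λ c → ∑-cong R (λ c′ → cong (when (d ℕ.* e ≡ᵇ n)) (sym (when-*ˡ (c ℕ.* c′ ≡ᵇ d) (μ e) (G c))))) ⟩
    ∑[ c ∈ R ] ∑[ c′ ∈ R ] term d e c c′ ∎
  factor-G : ∀ c → ∑[ c′ ∈ R ] ∑[ e ∈ R ] when (c ℕ.* c′ ℕ.* e ≡ᵇ n) (μ e * G c)
                 ≡ G c * ∑[ c′ ∈ R ] ∑[ e ∈ R ] when (c ℕ.* c′ ℕ.* e ≡ᵇ n) (μ e)
  factor-G c = trans (∑-cong R (λ c′ → trans (∑-cong R (λ e →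
      trans (cong (when (c ℕ.* c′ ℕ.* e ≡ᵇ n)) (ℤP.*-comm (μ e) (G c))) (when-*ˡ _ (G c) (μ e))))
      (∑-*ˡ R (G c) _))) (∑-*ˡ R (G c) _)

-- Coefficients of polynomial products

sumUpTo-cong : ∀ k {f g : ℕ → ℤ} → (∀ i → i ≤ k → f i ≡ g i) → sumUpTo k f ≡ sumUpTo k g
sumUpTo-cong zero    f≗g = f≗g 0 z≤n
sumUpTo-cong (suc k) f≗g = cong₂ _+_ (sumUpTo-cong k (λ i i≤k → f≗g i (ℕP.m≤n⇒m≤1+n i≤k))) (f≗g (suc k) ℕP.≤-refl)

sumUpTo-zero : ∀ k (f : ℕ → ℤ) → (∀ i → i ≤ k → f i ≡ 0ℤ) → sumUpTo k f ≡ 0ℤ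
sumUpTo-zero k f f≗0 = trans (sumUpTo-cong k f≗0) (sumUpTo-const0 k)
  where
  sumUpTo-const0 : ∀ k → sumUpTo k (λ _ → 0ℤ) ≡ 0ℤ
  sumUpTo-const0 zero    = refl
  sumUpTo-const0 (suc k) = cong (_+ 0ℤ) (sumUpTo-const0 k)

sumUpTo-shift : ∀ k (f : ℕ → ℤ) → sumUpTo (suc k) f ≡ f 0 + sumUpTo k (λ i → f (suc i))
sumUpTo-shift zero    f = refl
sumUpTo-shift (suc k) f = trans (cong (_+ f (suc (suc k))) (sumUpTo-shift k f)) (ℤP.+-assoc (f 0) _ _)

sumUpTo≡∑ : ∀ k (f : ℕ → ℤ) → sumUpTo k f ≡ ∑ (range 0 (suc k)) f
sumUpTo≡∑ zero    f = sym (ℤP.+-identityʳ (f 0))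
sumUpTo≡∑ (suc k) f = trans (cong (_+ f (suc k)) (sumUpTo≡∑ k f)) (sym (∑-range-suc 0 (suc k) f))

1+x : Poly
1+x = pconst 1ℤ p+ pX

1+x² : Poly
1+x² = pconst 1ℤ p+ (pX p^ 2)

x*-coeff-suc : ∀ Q k → (pX p* Q) (suc k) ≡ Q k
x*-coeff-suc Q zero    = trans (ℤP.+-identityˡ (1ℤ * Q 0)) (ℤP.*-identityˡ (Q 0))
x*-coeff-suc Q (suc k) = begin
  (pX p* Q) (suc (suc k))
    ≡⟨ sumUpTo-shift (suc k) (λ i → pX i * Q (suc (suc k) ∸ i)) ⟩
  0ℤ * Q (suc (suc k)) + sumUpTo (suc k) (λ i → pX (suc i) * Q (suc k ∸ i))
    ≡⟨ ℤP.+-identityˡ _ ⟩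
  sumUpTo (suc k) (λ i → pX (suc i) * Q (suc k ∸ i))
    ≡⟨ sumUpTo-shift k (λ i → pX (suc i) * Q (suc k ∸ i)) ⟩
  1ℤ * Q (suc k) + sumUpTo k (λ i → 0ℤ * Q (k ∸ i))
    ≡⟨ cong₂ _+_ (ℤP.*-identityˡ (Q (suc k))) (sumUpTo-zero k _ (λ i _ → refl)) ⟩
  Q (suc k) + 0ℤ
    ≡⟨ ℤP.+-identityʳ _ ⟩
  Q (suc k) ∎
  where open ≡-Reasoning

*-linear-coeff-suc : ∀ P B → (∀ j → B (suc (suc j)) ≡ 0ℤ) → ∀ k → (P p* B) (suc k) ≡ P (suc k) * B 0 + P k * B 1
*-linear-coeff-suc P B B-linear zero    = ℤP.+-comm (P 0 * B 1) (P 1 * B 0)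
*-linear-coeff-suc P B B-linear (suc k) =
  trans (cong₂ _+_ low-terms (cong (λ z → P (suc (suc k)) * B z) (ℕP.n∸n≡0 k)))
        (ℤP.+-comm (P (suc k) * B 1) (P (suc (suc k)) * B 0))
  where
  low-terms : sumUpTo (suc k) (λ i → P i * B (suc (suc k) ∸ i)) ≡ P (suc k) * B 1
  low-terms = trans
    (cong₂ _+_ (sumUpTo-zero k _ (λ i i≤k → trans (cong (λ z → P i * B z) (ℕP.+-∸-assoc 2 i≤k))
                                             (trans (cong (P i *_) (B-linear (k ∸ i))) (ℤP.*-zeroʳ (P i)))))
               (cong (λ z → P (suc k) * B z) (ℕP.m+n∸n≡m 1 (suc k))))
    (ℤP.+-identityˡ _)

p*-identityʳ : ∀ P k → (P p* pconst 1ℤ) k ≡ P k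
p*-identityʳ P zero    = ℤP.*-identityʳ (P 0)
p*-identityʳ P (suc k) = trans (*-linear-coeff-suc P (pconst 1ℤ) (λ _ → refl) k)
  (trans (cong₂ _+_ (ℤP.*-identityʳ (P (suc k))) (ℤP.*-zeroʳ (P k))) (ℤP.+-identityʳ (P (suc k))))

*[1+x]-coeff : ∀ P k → (P p* (1+x p^ 1)) k ≡ P k + when (1 ≤ᵇ k) (P (k ∸ 1))
*[1+x]-coeff P zero    = trans (cong (P 0 *_) (p*-identityʳ 1+x 0)) (trans (ℤP.*-identityʳ (P 0)) (sym (ℤP.+-identityʳ (P 0))))
*[1+x]-coeff P (suc k) = trans (*-linear-coeff-suc P (1+x p^ 1) (λ j → p*-identityʳ 1+x (suc (suc j))) k)
  (cong₂ _+_ (trans (cong (P (suc k) *_) (p*-identityʳ 1+x 0)) (ℤP.*-identityʳ (P (suc k))))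
             (trans (cong (P k *_) (p*-identityʳ 1+x 1)) (ℤP.*-identityʳ (P k))))

1+x²-coeff-≥3 : ∀ j → 1+x² (suc (suc (suc j))) ≡ 0ℤ
1+x²-coeff-≥3 j = trans (ℤP.+-identityˡ _) (trans (x*-coeff-suc (pX p* pconst 1ℤ) (suc (suc j))) (x*-coeff-suc (pconst 1ℤ) (suc j)))

[1+x²]*-coeff : ∀ P k → (1+x² p* P) k ≡ P k + when (2 ≤ᵇ k) (P (k ∸ 2))
[1+x²]*-coeff P zero          = trans (ℤP.*-identityˡ (P 0)) (sym (ℤP.+-identityʳ _))
[1+x²]*-coeff P (suc zero)    = cong₂ _+_ (ℤP.*-identityˡ (P 1)) (ℤP.*-zeroˡ (P 0))
[1+x²]*-coeff P (suc (suc k)) = begin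
  (1+x² p* P) (suc (suc k))
    ≡⟨ sumUpTo-shift (suc k) (λ i → 1+x² i * P (suc (suc k) ∸ i)) ⟩
  1ℤ * P (suc (suc k)) + sumUpTo (suc k) (λ i → 1+x² (suc i) * P (suc k ∸ i))
    ≡⟨ cong (λ z → 1ℤ * P (suc (suc k)) + z) (sumUpTo-shift k (λ i → 1+x² (suc i) * P (suc k ∸ i))) ⟩
  1ℤ * P (suc (suc k)) + (0ℤ * P (suc k) + sumUpTo k (λ i → 1+x² (suc (suc i)) * P (k ∸ i)))
    ≡⟨ cong (λ z → 1ℤ * P (suc (suc k)) + (0ℤ * P (suc k) + z)) (x²-term k) ⟩
  1ℤ * P (suc (suc k)) + (0ℤ * P (suc k) + P k)
    ≡⟨ cong₂ _+_ (ℤP.*-identityˡ (P (suc (suc k)))) (ℤP.+-identityˡ (P k)) ⟩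
  P (suc (suc k)) + P k ∎
  where
  open ≡-Reasoning
  x²-term : ∀ k → sumUpTo k (λ i → 1+x² (suc (suc i)) * P (k ∸ i)) ≡ P k
  x²-term zero    = ℤP.*-identityˡ (P 0)
  x²-term (suc k) = begin
    sumUpTo (suc k) (λ i → 1+x² (suc (suc i)) * P (suc k ∸ i))
      ≡⟨ sumUpTo-shift k (λ i → 1+x² (suc (suc i)) * P (suc k ∸ i)) ⟩
    1ℤ * P (suc k) + sumUpTo k (λ i → 1+x² (suc (suc (suc i))) * P (k ∸ i))
      ≡⟨ cong₂ _+_ (ℤP.*-identityˡ (P (suc k)))
                   (sumUpTo-zero k _ (λ i _ → trans (cong (_* P (k ∸ i)) (1+x²-coeff-≥3 i)) (ℤP.*-zeroˡ (P (k ∸ i))))) ⟩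
    P (suc k) + 0ℤ
      ≡⟨ ℤP.+-identityʳ _ ⟩
    P (suc k) ∎

sublists : List ℕ → List (List ℕ)
sublists []       = [] ∷ []
sublists (x ∷ xs) = map (x ∷_) (sublists xs) ++ sublists xs

weightSum : (ℕ → ℕ) → List ℕ → ℕ
weightSum w []      = 0
weightSum w (x ∷ T) = w x ℕ.+ weightSum w T

-- The polynomial ∏_{j ∈ L} (1 + x^(w j)).
weightCount : (ℕ → ℕ) → List ℕ → Poly
weightCount w L k = ∑[ T ∈ sublists L ] when (weightSum w T ≡ᵇ k) 1ℤ

weightCount-[] : ∀ w k → weightCount w [] k ≡ pconst 1ℤ k
weightCount-[] w zero    = refl
weightCount-[] w (suc k) = refl

weightCount-∷ : ∀ w x xs k → weightCount w (x ∷ xs) k ≡ weightCount w xs k + when (w x ≤ᵇ k) (weightCount w xs (k ∸ w x))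
weightCount-∷ w x xs k = begin
  ∑[ T ∈ map (x ∷_) (sublists xs) ++ sublists xs ] when (weightSum w T ≡ᵇ k) 1ℤ
    ≡⟨ ∑-++ (map (x ∷_) (sublists xs)) (sublists xs) _ ⟩
  ∑[ T ∈ map (x ∷_) (sublists xs) ] when (weightSum w T ≡ᵇ k) 1ℤ + weightCount w xs k
    ≡⟨ cong (_+ weightCount w xs k) (trans (∑-map (x ∷_) (sublists xs) (λ T → when (weightSum w T ≡ᵇ k) 1ℤ))
          (trans (∑-cong (sublists xs) (λ T → when-+≡ᵇ (w x) (weightSum w T) k 1ℤ)) (∑-when (sublists xs) (w x ≤ᵇ k) _))) ⟩
  when (w x ≤ᵇ k) (weightCount w xs (k ∸ w x)) + weightCount w xs k
    ≡⟨ ℤP.+-comm (when (w x ≤ᵇ k) (weightCount w xs (k ∸ w x))) (weightCount w xs k) ⟩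
  weightCount w xs k + when (w x ≤ᵇ k) (weightCount w xs (k ∸ w x)) ∎
  where open ≡-Reasoning

[1+x²]^-coeff : ∀ w s a k → (∀ j → j ∈ range s a → w j ≡ 2) → (1+x² p^ a) k ≡ weightCount w (range s a) k
[1+x²]^-coeff w s zero    k w≡2 = sym (weightCount-[] w k)
[1+x²]^-coeff w s (suc a) k w≡2 = begin
  (1+x² p* (1+x² p^ a)) k
    ≡⟨ [1+x²]*-coeff (1+x² p^ a) k ⟩
  (1+x² p^ a) k + when (2 ≤ᵇ k) ((1+x² p^ a) (k ∸ 2))
    ≡⟨ cong₂ _+_ ([1+x²]^-coeff w (suc s) a k w≡2′) (cong (when (2 ≤ᵇ k)) ([1+x²]^-coeff w (suc s) a (k ∸ 2) w≡2′)) ⟩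
  weightCount w (range (suc s) a) k + when (2 ≤ᵇ k) (weightCount w (range (suc s) a) (k ∸ 2))
    ≡⟨ sym (subst (λ ws → weightCount w (s ∷ range (suc s) a) k
                         ≡ weightCount w (range (suc s) a) k + when (ws ≤ᵇ k) (weightCount w (range (suc s) a) (k ∸ ws)))
                  (w≡2 s (here refl)) (weightCount-∷ w s (range (suc s) a) k)) ⟩
  weightCount w (range s (suc a)) k ∎
  where
  open ≡-Reasoning
  w≡2′ : ∀ j → j ∈ range (suc s) a → w j ≡ 2
  w≡2′ j j∈ = w≡2 j (there j∈)

when-shift-comm : ∀ a k (F : ℕ → ℤ) →
  when (a ≤ᵇ k) (when (1 ≤ᵇ k ∸ a) (F (k ∸ a ∸ 1))) ≡ when (1 ≤ᵇ k) (when (a ≤ᵇ k ∸ 1) (F (k ∸ 1 ∸ a)))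
when-shift-comm a k F = trans (shift-then-1 a k) (sym (1-then-shift k))
  where
  suc≤ᵇsuc : ∀ a k → (suc a ≤ᵇ suc k) ≡ (a ≤ᵇ k)
  suc≤ᵇsuc zero    k = refl
  suc≤ᵇsuc (suc a) k = refl
  shift-then-1 : ∀ a k → when (a ≤ᵇ k) (when (1 ≤ᵇ k ∸ a) (F (k ∸ a ∸ 1))) ≡ when (suc a ≤ᵇ k) (F (k ∸ suc a))
  shift-then-1 zero    zero    = refl
  shift-then-1 zero    (suc k) = refl
  shift-then-1 (suc a) zero    = refl
  shift-then-1 (suc a) (suc k) rewrite suc≤ᵇsuc a k | suc≤ᵇsuc (suc a) k = shift-then-1 a k
  1-then-shift : ∀ k → when (1 ≤ᵇ k) (when (a ≤ᵇ k ∸ 1) (F (k ∸ 1 ∸ a))) ≡ when (suc a ≤ᵇ k) (F (k ∸ suc a))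
  1-then-shift zero    = refl
  1-then-shift (suc k) rewrite suc≤ᵇsuc a k = refl

weightCount-∷ʳ : ∀ w xs y k → w y ≡ 1 → weightCount w (xs ++ (y ∷ [])) k ≡ weightCount w xs k + when (1 ≤ᵇ k) (weightCount w xs (k ∸ 1))
weightCount-∷ʳ w []       y k wy≡1 = subst (λ wy → weightCount w (y ∷ []) k ≡ weightCount w [] k + when (wy ≤ᵇ k) (weightCount w [] (k ∸ wy)))
                                            wy≡1 (weightCount-∷ w y [] k)
weightCount-∷ʳ w (x ∷ xs) y k wy≡1 = begin
  weightCount w (x ∷ (xs ++ (y ∷ []))) k
    ≡⟨ weightCount-∷ w x (xs ++ (y ∷ [])) k ⟩
  weightCount w (xs ++ (y ∷ [])) k + when (w x ≤ᵇ k) (weightCount w (xs ++ (y ∷ [])) (k ∸ w x))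
    ≡⟨ cong₂ _+_ (weightCount-∷ʳ w xs y k wy≡1) (cong (when (w x ≤ᵇ k)) (weightCount-∷ʳ w xs y (k ∸ w x) wy≡1)) ⟩
  (C k + P) + when (w x ≤ᵇ k) (C (k ∸ w x) + when (1 ≤ᵇ k ∸ w x) (C (k ∸ w x ∸ 1)))
    ≡⟨ cong (λ z → (C k + P) + z) (when-+ (w x ≤ᵇ k) _ _) ⟩
  (C k + P) + (Q + when (w x ≤ᵇ k) (when (1 ≤ᵇ k ∸ w x) (C (k ∸ w x ∸ 1))))
    ≡⟨ cong (λ z → (C k + P) + (Q + z)) (when-shift-comm (w x) k C) ⟩
  (C k + P) + (Q + R)
    ≡⟨ interchange (C k) P Q R ⟩
  (C k + Q) + (P + R)
    ≡⟨ cong (λ z → (C k + Q) + z) (sym (when-+ (1 ≤ᵇ k) _ _)) ⟩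
  (C k + Q) + when (1 ≤ᵇ k) (C (k ∸ 1) + when (w x ≤ᵇ k ∸ 1) (C (k ∸ 1 ∸ w x)))
    ≡⟨ sym (cong₂ _+_ (weightCount-∷ w x xs k) (cong (when (1 ≤ᵇ k)) (weightCount-∷ w x xs (k ∸ 1)))) ⟩
  weightCount w (x ∷ xs) k + when (1 ≤ᵇ k) (weightCount w (x ∷ xs) (k ∸ 1)) ∎
  where
  open ≡-Reasoning
  C : ℕ → ℤ
  C = weightCount w xs
  P = when (1 ≤ᵇ k) (C (k ∸ 1))
  Q = when (w x ≤ᵇ k) (C (k ∸ w x))
  R = when (1 ≤ᵇ k) (when (w x ≤ᵇ k ∸ 1) (C (k ∸ 1 ∸ w x)))

-- The size of {j, n − j} ⊆ ℤₙ.
weight : ℕ → ℕ → ℕ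
weight n j = if j ℕ.+ j ≡ᵇ n then 1 else 2

halfRange : ℕ → List ℕ
halfRange n = range 1 (n / 2)

parity : ∀ d → ∃ λ s → d ≡ s ℕ.* 2 ⊎ d ≡ suc (s ℕ.* 2)
parity zero    = 0 , inj₁ refl
parity (suc d) with parity d
... | s , inj₁ refl = s , inj₂ refl
... | s , inj₂ refl = suc s , inj₁ refl

even/2 : ∀ s → (s ℕ.* 2) / 2 ≡ s
even/2 s = DM.m*n/n≡m s 2

odd/2 : ∀ s → suc (s ℕ.* 2) / 2 ≡ s
odd/2 s = trans (DM.+-distrib-/-∣ʳ 1 {s ℕ.* 2} {2} (n∣m*n s)) (DM.m*n/n≡m s 2)

odd%2 : ∀ s → suc (s ℕ.* 2) % 2 ≡ 1
odd%2 s = DM.[m+kn]%n≡m%n 1 s 2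

even%2 : ∀ s → (s ℕ.* 2) % 2 ≡ 0
even%2 s = DM.m*n%n≡0 s 2

*2-*-comm : ∀ s e → s ℕ.* 2 ℕ.* e ≡ s ℕ.* e ℕ.* 2
*2-*-comm s e = trans (ℕP.*-assoc s 2 e) (trans (cong (s ℕ.*_) (ℕP.*-comm 2 e)) (sym (ℕP.*-assoc s e 2)))

*2≡+ : ∀ s → s ℕ.* 2 ≡ s ℕ.+ s
*2≡+ s = trans (ℕP.*-comm s 2) (cong (s ℕ.+_) (ℕP.+-identityʳ s))

-- For d = 2s + 1 every j ≤ s has weight 2; for d = 2s + 2 so does every j ≤ s, and d / 2 = s + 1 has weight 1.
weightCount-halfRange : ∀ d → 1 ≤ d → ∀ k →
  ((1+x² p^ ((d ∸ 1) / 2)) p* (1+x p^ (1 ∸ (d % 2)))) k ≡ weightCount (weight d) (halfRange d) k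
weightCount-halfRange (suc d′) _ k with parity d′
... | s , inj₁ refl rewrite even/2 s | odd/2 s | odd%2 s =
  trans (p*-identityʳ (1+x² p^ s) k) ([1+x²]^-coeff (weight (suc (s ℕ.* 2))) 1 s k weight≡2)
  where
  weight≡2 : ∀ j → j ∈ range 1 s → weight (suc (s ℕ.* 2)) j ≡ 2
  weight≡2 j _ = cong (λ b → if b then 1 else 2) (≡ᵇ-false (λ 2j≡odd → ℕP.even≢odd j s (trans (cong (j ℕ.+_) (ℕP.+-identityʳ j)) (trans 2j≡odd (cong suc (ℕP.*-comm s 2))))))
... | s , inj₂ refl rewrite odd/2 s | even%2 (suc s) | even/2 (suc s) = begin
  ((1+x² p^ s) p* (1+x p^ 1)) k
    ≡⟨ *[1+x]-coeff (1+x² p^ s) k ⟩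
  (1+x² p^ s) k + when (1 ≤ᵇ k) ((1+x² p^ s) (k ∸ 1))
    ≡⟨ cong₂ _+_ ([1+x²]^-coeff w 1 s k weight≡2) (cong (when (1 ≤ᵇ k)) ([1+x²]^-coeff w 1 s (k ∸ 1) weight≡2)) ⟩
  weightCount w (range 1 s) k + when (1 ≤ᵇ k) (weightCount w (range 1 s) (k ∸ 1))
    ≡⟨ sym (weightCount-∷ʳ w (range 1 s) (suc s) k weight≡1) ⟩
  weightCount w (range 1 s ++ (suc s ∷ [])) k
    ≡⟨ cong (λ L → weightCount w L k) (sym (range-snoc 1 s)) ⟩
  weightCount w (range 1 (suc s)) k ∎
  where
  open ≡-Reasoning
  w = weight (suc (suc (s ℕ.* 2)))
  weight≡2 : ∀ j → j ∈ range 1 s → w j ≡ 2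
  weight≡2 j j∈ = cong (λ b → if b then 1 else 2) (≡ᵇ-false (λ 2j≡d → ℕP.<-irrefl 2j≡d (s≤s (ℕP.m≤n⇒m≤1+n 2j≤2s))))
    where
    j≤s = ℕP.≤-pred (proj₂ (∈-range⁻ 1 s j∈))
    2j≤2s : j ℕ.+ j ≤ s ℕ.* 2
    2j≤2s = subst (j ℕ.+ j ≤_) (sym (*2≡+ s)) (ℕP.+-mono-≤ j≤s j≤s)
  weight≡1 : w (suc s) ≡ 1
  weight≡1 = cong (λ b → if b then 1 else 2) (≡ᵇ-true (trans (cong suc (ℕP.+-suc s s)) (cong (λ z → suc (suc z)) (sym (*2≡+ s)))))

-- Sorting sublists by their gcd

gcdWith : ℕ → List ℕ → ℕ
gcdWith n []      = n
gcdWith n (x ∷ T) = gcd x (gcdWith n T)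

sublistSum : (ℕ → ℤ) → ℕ → ℤ
sublistSum φ n = ∑[ T ∈ sublists (halfRange n) ] φ (weightSum (weight n) T)

coprimeSublistSum : (ℕ → ℤ) → ℕ → ℤ
coprimeSublistSum φ n = ∑[ T ∈ sublists (halfRange n) ] when (gcdWith n T ≡ᵇ 1) (φ (weightSum (weight n) T))

divisibleBy : ℕ → ℕ → Bool
divisibleBy e j = does (e ∣? j)

∑-sublists-all : ∀ p L (F : List ℕ → ℤ) →
                 ∑[ T ∈ sublists L ] when (all p T) (F T) ≡ ∑ (sublists (List.filterᵇ p L)) F
∑-sublists-all p []       F = refl
∑-sublists-all p (x ∷ xs) F with p x in px
... | true  = begin
  ∑[ T ∈ map (x ∷_) (sublists xs) ++ sublists xs ] when (all p T) (F T)
    ≡⟨ ∑-++ (map (x ∷_) (sublists xs)) (sublists xs) _ ⟩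
  ∑[ T ∈ map (x ∷_) (sublists xs) ] when (all p T) (F T) + ∑[ T ∈ sublists xs ] when (all p T) (F T)
    ≡⟨ cong₂ _+_ (trans (∑-map (x ∷_) (sublists xs) _)
                        (trans (∑-cong (sublists xs) (λ T → cong (λ b → when (b ∧ all p T) (F (x ∷ T))) px))
                               (∑-sublists-all p xs (λ T → F (x ∷ T)))))
                 (∑-sublists-all p xs F) ⟩
  ∑[ T ∈ sublists (List.filterᵇ p xs) ] F (x ∷ T) + ∑ (sublists (List.filterᵇ p xs)) F
    ≡⟨ cong (_+ ∑ (sublists (List.filterᵇ p xs)) F) (sym (∑-map (x ∷_) (sublists (List.filterᵇ p xs)) F)) ⟩
  ∑ (map (x ∷_) (sublists (List.filterᵇ p xs))) F + ∑ (sublists (List.filterᵇ p xs)) F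
    ≡⟨ sym (∑-++ (map (x ∷_) (sublists (List.filterᵇ p xs))) (sublists (List.filterᵇ p xs)) F) ⟩
  ∑ (sublists (x ∷ List.filterᵇ p xs)) F ∎
  where open ≡-Reasoning
... | false = begin
  ∑[ T ∈ map (x ∷_) (sublists xs) ++ sublists xs ] when (all p T) (F T)
    ≡⟨ ∑-++ (map (x ∷_) (sublists xs)) (sublists xs) _ ⟩
  ∑[ T ∈ map (x ∷_) (sublists xs) ] when (all p T) (F T) + ∑[ T ∈ sublists xs ] when (all p T) (F T)
    ≡⟨ cong₂ _+_ (trans (∑-map (x ∷_) (sublists xs) _)
                        (∑-zero (sublists xs) _ (λ T _ → cong (λ b → when (b ∧ all p T) (F (x ∷ T))) px)))
                 (∑-sublists-all p xs F) ⟩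
  0ℤ + ∑ (sublists (List.filterᵇ p xs)) F
    ≡⟨ ℤP.+-identityˡ _ ⟩
  ∑ (sublists (List.filterᵇ p xs)) F ∎
  where open ≡-Reasoning

sublists-map : ∀ (f : ℕ → ℕ) L → sublists (map f L) ≡ map (map f) (sublists L)
sublists-map f []       = refl
sublists-map f (x ∷ xs) rewrite sublists-map f xs =
  sym (trans (LP.map-++ (map f) (map (x ∷_) (sublists xs)) (sublists xs))
             (cong (_++ map (map f) (sublists xs)) (trans (sym (LP.map-∘ (sublists xs))) (LP.map-∘ (sublists xs)))))

filterᵇ-range-snoc : ∀ (p : ℕ → Bool) N → List.filterᵇ p (range 1 (suc N)) ≡ List.filterᵇ p (range 1 N) ++ List.filterᵇ p (suc N ∷ [])
filterᵇ-range-snoc p N = trans (cong (List.filterᵇ p) (range-snoc 1 N)) (LP.filter-++ _ (range 1 N) _)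

map-range-snoc : ∀ (f : ℕ → ℕ) t → map f (range 1 (suc t)) ≡ map f (range 1 t) ++ (f (suc t) ∷ [])
map-range-snoc f t = trans (cong (map f) (range-snoc 1 t)) (LP.map-++ f (range 1 t) _)

filter-divisible-range : ∀ e → 1 ≤ e → ∀ N t → t ℕ.* e ≤ N → N < suc t ℕ.* e →
                         List.filterᵇ (divisibleBy e) (range 1 N) ≡ map (e ℕ.*_) (range 1 t)
filter-divisible-range e 1≤e zero    zero    _ _ = refl
filter-divisible-range e 1≤e zero    (suc t) te≤0 _ = ⊥-elim (ℕP.<-irrefl refl (ℕP.≤-trans (ℕP.≤-trans 1≤e (ℕP.m≤m+n e (t ℕ.* e))) te≤0))
filter-divisible-range e 1≤e (suc N) t te≤N N<t′e with t ℕ.* e ≟ suc N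
filter-divisible-range e 1≤e (suc N) zero     _ _ | yes ()
filter-divisible-range e 1≤e (suc N) (suc t′) _ _ | yes t′e≡N =
  trans (filterᵇ-range-snoc (divisibleBy e) N)
        (trans (cong₂ _++_ (filter-divisible-range e 1≤e N t′ t′e≤N N<t′e′) last) (sym (map-range-snoc (e ℕ.*_) t′)))
  where
  t′e≤N : t′ ℕ.* e ≤ N
  t′e≤N = ℕP.≤-pred (subst (suc (t′ ℕ.* e) ≤_) t′e≡N (ℕP.+-monoˡ-≤ (t′ ℕ.* e) 1≤e))
  N<t′e′ : N < suc t′ ℕ.* e
  N<t′e′ = subst (N <_) (sym t′e≡N) ℕP.≤-refl
  last : List.filterᵇ (divisibleBy e) (suc N ∷ []) ≡ (e ℕ.* suc t′ ∷ [])
  last rewrite dec-true (e ∣? suc N) (divides (suc t′) (sym t′e≡N)) = cong (_∷ []) (trans (sym t′e≡N) (ℕP.*-comm (suc t′) e))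
filter-divisible-range e 1≤e (suc N) t te≤N N<t′e | no te≢N =
  trans (filterᵇ-range-snoc (divisibleBy e) N)
        (trans (cong₂ _++_ (filter-divisible-range e 1≤e N t te<N′ (ℕP.<-trans (ℕP.n<1+n N) N<t′e)) last) (LP.++-identityʳ _))
  where
  te<N′ : t ℕ.* e ≤ N
  te<N′ = ℕP.≤-pred (ℕP.≤∧≢⇒< te≤N te≢N)
  e∤N : ¬ e ∣ suc N
  e∤N (divides q N≡qe) = ℕP.<-irrefl refl (ℕP.≤-trans t<q q≤t)
    where
    t<q = ℕP.*-cancelʳ-< e t q (subst (t ℕ.* e <_) N≡qe (ℕP.≤∧≢⇒< te≤N te≢N))
    q≤t = ℕP.≤-pred (ℕP.*-cancelʳ-< e q (suc t) (subst (_< suc t ℕ.* e) N≡qe N<t′e))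
  last : List.filterᵇ (divisibleBy e) (suc N ∷ []) ≡ []
  last rewrite dec-false (e ∣? suc N) e∤N = refl

filter-divisible-halfRange : ∀ d e → 1 ≤ e → List.filterᵇ (divisibleBy e) (halfRange (d ℕ.* e)) ≡ map (e ℕ.*_) (halfRange d)
filter-divisible-halfRange d e 1≤e with parity d
... | s , inj₁ refl = trans (cong (λ z → List.filterᵇ (divisibleBy e) (range 1 z)) half)
  (trans (filter-divisible-range e 1≤e (s ℕ.* e) s ℕP.≤-refl (ℕP.m<n+m (s ℕ.* e) 1≤e))
         (cong (λ z → map (e ℕ.*_) (range 1 z)) (sym (even/2 s))))
  where
  half : (s ℕ.* 2 ℕ.* e) / 2 ≡ s ℕ.* e
  half = trans (cong (_/ 2) (*2-*-comm s e)) (even/2 (s ℕ.* e))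
... | s , inj₂ refl = trans (cong (λ z → List.filterᵇ (divisibleBy e) (range 1 z)) half)
  (trans (filter-divisible-range e 1≤e (e / 2 ℕ.+ s ℕ.* e) s (ℕP.m≤n+m (s ℕ.* e) (e / 2)) e/2+se<e+se)
         (cong (λ z → map (e ℕ.*_) (range 1 z)) (sym (odd/2 s))))
  where
  half : (suc (s ℕ.* 2) ℕ.* e) / 2 ≡ e / 2 ℕ.+ s ℕ.* e
  half = trans (cong (λ z → (e ℕ.+ z) / 2) (*2-*-comm s e))
               (trans (DM.+-distrib-/-∣ʳ e (n∣m*n (s ℕ.* e))) (cong (e / 2 ℕ.+_) (even/2 (s ℕ.* e))))
  e/2+se<e+se : e / 2 ℕ.+ s ℕ.* e < e ℕ.+ s ℕ.* e
  e/2+se<e+se = ℕP.+-monoˡ-< (s ℕ.* e) (DM.m/n<m e 2 {{ℕ.>-nonZero 1≤e}} (s≤s (s≤s z≤n)))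

gcdWith-* : ∀ d e T → gcdWith (d ℕ.* e) (map (e ℕ.*_) T) ≡ e ℕ.* gcdWith d T
gcdWith-* d e []      = ℕP.*-comm d e
gcdWith-* d e (x ∷ T) rewrite gcdWith-* d e T = sym (c*gcd[m,n]≡gcd[cm,cn] e x (gcdWith d T))

weight-* : ∀ d e j → 1 ≤ e → weight (d ℕ.* e) (e ℕ.* j) ≡ weight d j
weight-* d e j 1≤e = cong (λ b → if b then 1 else 2) (≡ᵇ-cong {e ℕ.* j ℕ.+ e ℕ.* j} {d ℕ.* e} {j ℕ.+ j} {d} (mk⇔
  (λ eq → ℕP.*-cancelˡ-≡ (j ℕ.+ j) d e {{ℕ.>-nonZero 1≤e}} (trans (ℕP.*-distribˡ-+ e j j) (trans eq (ℕP.*-comm d e))))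
  (λ eq → trans (sym (ℕP.*-distribˡ-+ e j j)) (trans (cong (e ℕ.*_) eq) (ℕP.*-comm e d)))))

weightSum-* : ∀ d e T → 1 ≤ e → weightSum (weight (d ℕ.* e)) (map (e ℕ.*_) T) ≡ weightSum (weight d) T
weightSum-* d e []      _   = refl
weightSum-* d e (x ∷ T) 1≤e = cong₂ ℕ._+_ (weight-* d e x 1≤e) (weightSum-* d e T 1≤e)

gcdWith∣n : ∀ n T → gcdWith n T ∣ n
gcdWith∣n n []      = ∣-refl
gcdWith∣n n (x ∷ T) = ∣-trans (gcd[m,n]∣n x (gcdWith n T)) (gcdWith∣n n T)

gcdWith∣∈ : ∀ n T {j} → j ∈ T → gcdWith n T ∣ j
gcdWith∣∈ n (x ∷ T) (here refl) = gcd[m,n]∣m x (gcdWith n T)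
gcdWith∣∈ n (x ∷ T) (there j∈)  = ∣-trans (gcd[m,n]∣n x (gcdWith n T)) (gcdWith∣∈ n T j∈)

gcdWith≥1 : ∀ n T → 1 ≤ n → 1 ≤ gcdWith n T
gcdWith≥1 n T 1≤n with gcdWith n T | gcdWith∣n n T
... | zero  | 0∣n = ⊥-elim (ℕP.<-irrefl refl (subst (1 ≤_) (0∣⇒≡0 0∣n) 1≤n))
... | suc _ | _   = s≤s z≤n

all-divisible : ∀ e T → (∀ {j} → j ∈ T → e ∣ j) → all (divisibleBy e) T ≡ true
all-divisible e []      e∣T = refl
all-divisible e (x ∷ T) e∣T rewrite dec-true (e ∣? x) (e∣T (here refl)) = all-divisible e T (λ j∈ → e∣T (there j∈))

-- The sublists of [1, ⌊de/2⌋] of gcd e with de are the e · T′, T′ ⊆ [1, ⌊d/2⌋] coprime to d, of the same weight.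
∑-sublists-gcd≡ : ∀ (φ : ℕ → ℤ) d e → 1 ≤ e →
  ∑[ T ∈ sublists (halfRange (d ℕ.* e)) ] when (gcdWith (d ℕ.* e) T ≡ᵇ e) (φ (weightSum (weight (d ℕ.* e)) T))
  ≡ coprimeSublistSum φ d
∑-sublists-gcd≡ φ d e 1≤e = begin
  ∑[ T ∈ sublists (halfRange n) ] F T
    ≡⟨ ∑-cong (sublists (halfRange n)) only-multiples ⟩
  ∑[ T ∈ sublists (halfRange n) ] when (all (divisibleBy e) T) (F T)
    ≡⟨ ∑-sublists-all (divisibleBy e) (halfRange n) F ⟩
  ∑ (sublists (List.filterᵇ (divisibleBy e) (halfRange n))) F
    ≡⟨ cong (λ L → ∑ (sublists L) F) (filter-divisible-halfRange d e 1≤e) ⟩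
  ∑ (sublists (map (e ℕ.*_) (halfRange d))) F
    ≡⟨ cong (λ Ts → ∑ Ts F) (sublists-map (e ℕ.*_) (halfRange d)) ⟩
  ∑ (map (map (e ℕ.*_)) (sublists (halfRange d))) F
    ≡⟨ ∑-map (map (e ℕ.*_)) (sublists (halfRange d)) F ⟩
  ∑[ T ∈ sublists (halfRange d) ] F (map (e ℕ.*_) T)
    ≡⟨ ∑-cong (sublists (halfRange d)) (λ T → cong₂ when (gcd-scaled T) (cong φ (weightSum-* d e T 1≤e))) ⟩
  coprimeSublistSum φ d ∎
  where
  open ≡-Reasoning
  n = d ℕ.* e
  instance e≢0 = ℕ.>-nonZero 1≤e
  F : List ℕ → ℤ
  F T = when (gcdWith n T ≡ᵇ e) (φ (weightSum (weight n) T))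
  only-multiples : ∀ T → F T ≡ when (all (divisibleBy e) T) (F T)
  only-multiples T with gcdWith n T ≟ e
  ... | yes g≡e rewrite all-divisible e T (λ j∈ → subst (_∣ _) g≡e (gcdWith∣∈ n T j∈)) = refl
  ... | no  g≢e rewrite ≡ᵇ-false g≢e = sym (when-zero _)
  gcd-scaled : ∀ T → (gcdWith n (map (e ℕ.*_) T) ≡ᵇ e) ≡ (gcdWith d T ≡ᵇ 1)
  gcd-scaled T = trans (cong (_≡ᵇ e) (gcdWith-* d e T)) (≡ᵇ-cong {e ℕ.* gcdWith d T} {e} {gcdWith d T} {1} (mk⇔
    (λ eq → ℕP.*-cancelˡ-≡ (gcdWith d T) 1 e (trans eq (sym (ℕP.*-identityʳ e))))
    (λ eq → trans (cong (e ℕ.*_) eq) (ℕP.*-identityʳ e))))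

sublistSum≡divSum : ∀ (φ : ℕ → ℤ) n → 1 ≤ n → sublistSum φ n ≡ divSum n (λ d _ → coprimeSublistSum φ d)
sublistSum≡divSum φ n 1≤n = begin
  sublistSum φ n
    ≡⟨ ∑-cong (sublists (halfRange n)) split-by-gcd ⟩
  ∑[ T ∈ sublists (halfRange n) ] ∑[ d ∈ R ] ∑[ e ∈ R ] when (d ℕ.* e ≡ᵇ n) (F e T)
    ≡⟨ ∑-comm (sublists (halfRange n)) R _ ⟩
  ∑[ d ∈ R ] ∑[ T ∈ sublists (halfRange n) ] ∑[ e ∈ R ] when (d ℕ.* e ≡ᵇ n) (F e T)
    ≡⟨ ∑-cong R (λ d → ∑-comm (sublists (halfRange n)) R _) ⟩
  ∑[ d ∈ R ] ∑[ e ∈ R ] ∑[ T ∈ sublists (halfRange n) ] when (d ℕ.* e ≡ᵇ n) (F e T)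
    ≡⟨ ∑-cong R (λ d → ∑-cong R (λ e → ∑-when (sublists (halfRange n)) (d ℕ.* e ≡ᵇ n) (F e))) ⟩
  ∑[ d ∈ R ] ∑[ e ∈ R ] when (d ℕ.* e ≡ᵇ n) (∑ (sublists (halfRange n)) (F e))
    ≡⟨ ∑-cong R (λ d → ∑-cong-∈ R (λ e e∈ → when-cong (d ℕ.* e ≡ᵇ n) (λ de≡n →
         gcd-class d e (proj₁ (∈-range1⁻ e∈)) (≡ᵇ⇒≡ de≡n)))) ⟩
  divSum n (λ d _ → coprimeSublistSum φ d) ∎
  where
  open ≡-Reasoning
  R = range 1 n
  F : ℕ → List ℕ → ℤ
  F e T = when (gcdWith n T ≡ᵇ e) (φ (weightSum (weight n) T))
  gcd-class : ∀ d e → 1 ≤ e → d ℕ.* e ≡ n → ∑ (sublists (halfRange n)) (F e) ≡ coprimeSublistSum φ d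
  gcd-class d e 1≤e refl = ∑-sublists-gcd≡ φ d e 1≤e
  split-by-gcd : ∀ T → φ (weightSum (weight n) T) ≡ ∑[ d ∈ R ] ∑[ e ∈ R ] when (d ℕ.* e ≡ᵇ n) (F e T)
  split-by-gcd T = sym (begin
    ∑[ d ∈ R ] ∑[ e ∈ R ] when (d ℕ.* e ≡ᵇ n) (when (g ≡ᵇ e) v)
      ≡⟨ ∑-cong R (λ d → ∑-cong R (λ e → trans (when-comm (d ℕ.* e ≡ᵇ n) (g ≡ᵇ e) v)
                                              (cong (λ b → when b (when (d ℕ.* e ≡ᵇ n) v)) (≡ᵇ-sym g e)))) ⟩
    ∑[ d ∈ R ] ∑[ e ∈ R ] when (e ≡ᵇ g) (when (d ℕ.* e ≡ᵇ n) v)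
      ≡⟨ ∑-cong R (λ d → ∑-range-indicator 1 n g (λ e → when (d ℕ.* e ≡ᵇ n) v) (gcdWith≥1 n T 1≤n) (s≤s (∣⇒≤′ (gcdWith∣n n T) 1≤n))) ⟩
    ∑[ d ∈ R ] when (d ℕ.* g ≡ᵇ n) v
      ≡⟨ ∑-cofactor n g v (gcdWith≥1 n T 1≤n) 1≤n ⟩
    when (does (g ∣? n)) v
      ≡⟨ cong (λ b → when b v) (dec-true (g ∣? n) (gcdWith∣n n T)) ⟩
    v ∎)
    where
    g = gcdWith n T
    v = φ (weightSum (weight n) T)

coprimeSublistSum-möbius : ∀ (φ : ℕ → ℤ) n → 1 ≤ n → divSum n (λ d e → μ e * sublistSum φ d) ≡ coprimeSublistSum φ n
coprimeSublistSum-möbius φ = möbius-inversion (sublistSum φ) (coprimeSublistSum φ) (sublistSum≡divSum φ)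

δ : ℕ → ℕ → ℤ
δ k w = when (w ≡ᵇ k) 1ℤ

divSum-μ-minus : ∀ n (F : ℕ → ℤ) (c : ℤ) → 1 ≤ n →
  divSum n (λ d e → μ e * (F d - c)) ≡ divSum n (λ d e → μ e * F d) - c * when (n ≡ᵇ 1) 1ℤ
divSum-μ-minus n F c 1≤n = begin
  divSum n (λ d e → μ e * (F d - c))
    ≡⟨ divSum-cong n (λ d e _ → distrib (μ e) (F d) c) ⟩
  divSum n (λ d e → μ e * F d - c * μ e)
    ≡⟨ divSum-- n _ _ ⟩
  divSum n (λ d e → μ e * F d) - divSum n (λ d e → c * μ e)
    ≡⟨ cong (λ s → divSum n (λ d e → μ e * F d) - s) (trans (divSum-*ˡ n c (λ _ e → μ e)) (cong (c *_) (divSum-μ n 1≤n))) ⟩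
  divSum n (λ d e → μ e * F d) - c * when (n ≡ᵇ 1) 1ℤ ∎
  where
  open ≡-Reasoning
  distrib : ∀ m a c → m * (a - c) ≡ m * a - c * m
  distrib = solve-∀

psiFormula≡ : ∀ n → 1 ≤ n → ∀ k → psiFormula n k ≡ coprimeSublistSum (δ k) n - pconst 1ℤ k * when (n ≡ᵇ 1) 1ℤ
psiFormula≡ n 1≤n k = begin
  psiFormula n k
    ≡⟨ divisorSum≡divSum n _ ⟩
  divSum n (λ d e → μ e * (((1+x² p^ ((d ∸ 1) / 2)) p* (1+x p^ (1 ∸ (d % 2)))) k - pconst 1ℤ k))
    ≡⟨ divSum-cong n (λ d e 1≤d → cong (λ z → μ e * (z - pconst 1ℤ k)) (weightCount-halfRange d 1≤d k)) ⟩
  divSum n (λ d e → μ e * (sublistSum (δ k) d - pconst 1ℤ k))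
    ≡⟨ divSum-μ-minus n (sublistSum (δ k)) (pconst 1ℤ k) 1≤n ⟩
  divSum n (λ d e → μ e * sublistSum (δ k) d) - pconst 1ℤ k * when (n ≡ᵇ 1) 1ℤ
    ≡⟨ cong (_- pconst 1ℤ k * when (n ≡ᵇ 1) 1ℤ) (coprimeSublistSum-möbius (δ k) n 1≤n) ⟩
  coprimeSublistSum (δ k) n - pconst 1ℤ k * when (n ≡ᵇ 1) 1ℤ ∎
  where open ≡-Reasoning

∑-sublists-1 : ∀ L → ∑[ _ ∈ sublists L ] 1ℤ ≡ + (2 ℕ.^ length L)
∑-sublists-1 []       = refl
∑-sublists-1 (x ∷ xs) = begin
  ∑[ _ ∈ map (x ∷_) (sublists xs) ++ sublists xs ] 1ℤ
    ≡⟨ ∑-++ (map (x ∷_) (sublists xs)) (sublists xs) (λ _ → 1ℤ) ⟩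
  ∑[ _ ∈ map (x ∷_) (sublists xs) ] 1ℤ + ∑[ _ ∈ sublists xs ] 1ℤ
    ≡⟨ cong₂ _+_ (trans (∑-map (x ∷_) (sublists xs) (λ _ → 1ℤ)) (∑-sublists-1 xs)) (∑-sublists-1 xs) ⟩
  + (2 ℕ.^ length xs ℕ.+ 2 ℕ.^ length xs)
    ≡⟨ cong (λ z → + (2 ℕ.^ length xs ℕ.+ z)) (sym (ℕP.+-identityʳ _)) ⟩
  + (2 ℕ.^ length (x ∷ xs)) ∎
  where open ≡-Reasoning

EFormula≡ : ∀ n → 1 ≤ n → EFormula n ≡ coprimeSublistSum (λ _ → 1ℤ) n - when (n ≡ᵇ 1) 1ℤ
EFormula≡ n 1≤n = begin
  EFormula n
    ≡⟨ divisorSum≡divSum n _ ⟩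
  divSum n (λ d e → μ e * (+ (2 ℕ.^ (d / 2)) - 1ℤ))
    ≡⟨ divSum-cong n (λ d e _ → cong (λ z → μ e * (z - 1ℤ)) (sym (subsets-count d))) ⟩
  divSum n (λ d e → μ e * (sublistSum (λ _ → 1ℤ) d - 1ℤ))
    ≡⟨ divSum-μ-minus n (sublistSum (λ _ → 1ℤ)) 1ℤ 1≤n ⟩
  divSum n (λ d e → μ e * sublistSum (λ _ → 1ℤ) d) - 1ℤ * when (n ≡ᵇ 1) 1ℤ
    ≡⟨ cong₂ _-_ (coprimeSublistSum-möbius (λ _ → 1ℤ) n 1≤n) (ℤP.*-identityˡ _) ⟩
  coprimeSublistSum (λ _ → 1ℤ) n - when (n ≡ᵇ 1) 1ℤ ∎
  where
  open ≡-Reasoning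
  subsets-count : ∀ d → sublistSum (λ _ → 1ℤ) d ≡ + (2 ℕ.^ (d / 2))
  subsets-count d = trans (∑-sublists-1 (halfRange d)) (cong (λ z → + (2 ℕ.^ z)) (length-range 1 (d / 2)))

weightSum-∷≢0 : ∀ n x T → (weightSum (weight n) (x ∷ T) ≡ᵇ 0) ≡ false
weightSum-∷≢0 n x T with x ℕ.+ x ≡ᵇ n
... | true  = refl
... | false = refl

∑-sublists-weight0 : ∀ n L (F : List ℕ → ℤ) → ∑[ T ∈ sublists L ] when (weightSum (weight n) T ≡ᵇ 0) (F T) ≡ F []
∑-sublists-weight0 n []       F = ℤP.+-identityʳ (F [])
∑-sublists-weight0 n (x ∷ xs) F = begin
  ∑[ T ∈ map (x ∷_) (sublists xs) ++ sublists xs ] when (weightSum (weight n) T ≡ᵇ 0) (F T)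
    ≡⟨ ∑-++ (map (x ∷_) (sublists xs)) (sublists xs) _ ⟩
  ∑[ T ∈ map (x ∷_) (sublists xs) ] when (weightSum (weight n) T ≡ᵇ 0) (F T) + ∑[ T ∈ sublists xs ] when (weightSum (weight n) T ≡ᵇ 0) (F T)
    ≡⟨ cong₂ _+_ (trans (∑-map (x ∷_) (sublists xs) _)
                        (∑-zero (sublists xs) _ (λ T _ → cong (λ b → when b (F (x ∷ T))) (weightSum-∷≢0 n x T))))
                 (∑-sublists-weight0 n xs F) ⟩
  0ℤ + F []
    ≡⟨ ℤP.+-identityˡ (F []) ⟩
  F [] ∎
  where open ≡-Reasoning

coprimeSublistSum-δ0 : ∀ n → coprimeSublistSum (δ 0) n ≡ when (n ≡ᵇ 1) 1ℤ
coprimeSublistSum-δ0 n = trans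
  (∑-cong (sublists (halfRange n)) (λ T → when-comm (gcdWith n T ≡ᵇ 1) (weightSum (weight n) T ≡ᵇ 0) 1ℤ))
  (∑-sublists-weight0 n (halfRange n) (λ T → when (gcdWith n T ≡ᵇ 1) 1ℤ))

unique-range : ∀ a k → Unique (range a k)
unique-range a zero    = []
unique-range a (suc k) = All.tabulate (λ y∈ → ℕP.<⇒≢ (proj₁ (∈-range⁻ (suc a) k y∈))) ∷ unique-range (suc a) k

∈-sublists⇒⊆ : ∀ {L S j} → S ∈ sublists L → j ∈ S → j ∈ L
∈-sublists⇒⊆ {[]}     (here refl) ()
∈-sublists⇒⊆ {x ∷ xs} S∈ j∈ with ∈-++⁻ (map (x ∷_) (sublists xs)) S∈
... | inj₂ S∈′ = there (∈-sublists⇒⊆ S∈′ j∈)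
... | inj₁ S∈′ with ∈-map⁻ (x ∷_) S∈′
...   | S′ , S′∈ , refl with j∈
...     | here refl = here refl
...     | there j∈′ = there (∈-sublists⇒⊆ S′∈ j∈′)

∈-sublists⇒unique : ∀ {L S} → Unique L → S ∈ sublists L → Unique S
∈-sublists⇒unique {[]}     _          (here refl) = []
∈-sublists⇒unique {x ∷ xs} (x∉ ∷ uxs) S∈ with ∈-++⁻ (map (x ∷_) (sublists xs)) S∈
... | inj₂ S∈′ = ∈-sublists⇒unique uxs S∈′
... | inj₁ S∈′ with ∈-map⁻ (x ∷_) S∈′
...   | S′ , S′∈ , refl = All.tabulate (λ y∈ x≡y → All¬⇒¬Any x∉ (subst (_∈ xs) (sym x≡y) (∈-sublists⇒⊆ S′∈ y∈)))
                          ∷ ∈-sublists⇒unique uxs S′∈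

filter-∈-sublists : ∀ p L → List.filterᵇ p L ∈ sublists L
filter-∈-sublists p []       = here refl
filter-∈-sublists p (x ∷ xs) with p x
... | true  = ∈-++⁺ˡ (∈-map⁺ (x ∷_) (filter-∈-sublists p xs))
... | false = ∈-++⁺ʳ (map (x ∷_) (sublists xs)) (filter-∈-sublists p xs)

filter-recovers-sublist : ∀ L S (p : ℕ → Bool) → Unique L → S ∈ sublists L →
                          (∀ {j} → j ∈ L → p j ≡ true ⇔ j ∈ S) → List.filterᵇ p L ≡ S
filter-recovers-sublist []       .[] p _ (here refl) _ = refl
filter-recovers-sublist (x ∷ xs) S p (x∉ ∷ uxs) S∈ p⇔∈ with ∈-++⁻ (map (x ∷_) (sublists xs)) S∈
... | inj₂ S∈′ with p x in px
...   | true  = ⊥-elim (All¬⇒¬Any x∉ (∈-sublists⇒⊆ S∈′ (Equivalence.to (p⇔∈ (here refl)) px)))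
...   | false = filter-recovers-sublist xs S p uxs S∈′ (λ j∈ → p⇔∈ (there j∈))
filter-recovers-sublist (x ∷ xs) S p (x∉ ∷ uxs) S∈ p⇔∈ | inj₁ S∈′ with ∈-map⁻ (x ∷_) S∈′
... | S′ , S′∈ , refl with p x in px
...   | true  = cong (x ∷_) (filter-recovers-sublist xs S′ p uxs S′∈ (λ j∈ → mk⇔
                  (λ pj → drop-x j∈ (Equivalence.to (p⇔∈ (there j∈)) pj))
                  (λ j∈S′ → Equivalence.from (p⇔∈ (there j∈)) (there j∈S′))))
  where
  drop-x : ∀ {j} → j ∈ xs → j ∈ x ∷ S′ → j ∈ S′
  drop-x j∈ (here refl) = ⊥-elim (All¬⇒¬Any x∉ j∈)
  drop-x j∈ (there j∈S′) = j∈S′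
...   | false = case trans (sym px) (Equivalence.from (p⇔∈ (here refl)) (here refl)) of λ ()

unique-sublists : ∀ L → Unique L → Unique (sublists L)
unique-sublists []       _          = [] ∷ []
unique-sublists (x ∷ xs) (x∉ ∷ uxs) = AllPairsₚ.++⁺
  (AllPairsₚ.map⁺ (AllPairs.map (λ S≢S′ xS≡xS′ → S≢S′ (LP.∷-injectiveʳ xS≡xS′)) (unique-sublists xs uxs)))
  (unique-sublists xs uxs)
  (head-differs (sublists xs) (λ S∈ → S∈))
  where
  head-differs : ∀ Ss → (∀ {S} → S ∈ Ss → S ∈ sublists xs) → All (λ A → All (λ B → ¬ A ≡ B) (sublists xs)) (map (x ∷_) Ss)
  head-differs []       _   = []
  head-differs (S ∷ Ss) Ss⊆ = All.tabulate (λ B∈ xS≡B → All¬⇒¬Any x∉ (∈-sublists⇒⊆ B∈ (subst (x ∈_) xS≡B (here refl))))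
                              ∷ head-differs Ss (λ S∈ → Ss⊆ (there S∈))

∣tabulate∣≡∑ : ∀ k (b : ℕ → Bool) → + ∣ tabulate {n = k} (λ i → b (toℕ i)) ∣ ≡ ∑[ x ∈ range 0 k ] when (b x) 1ℤ
∣tabulate∣≡∑ zero    b = refl
∣tabulate∣≡∑ (suc k) b with b 0 | ∣tabulate∣≡∑ k (λ x → b (suc x))
... | true  | ih = cong (λ s → 1ℤ + s) (trans ih (sym (∑-range-suc-shift 0 k (λ x → when (b x) 1ℤ))))
... | false | ih = trans ih (trans (sym (∑-range-suc-shift 0 k (λ x → when (b x) 1ℤ))) (sym (ℤP.+-identityˡ _)))

allPairs-mapWith∈ : {A B : Set} {R : A → A → Set} {S : B → B → Set} (xs : List A) (f : ∀ {x} → x ∈ xs → B) →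
  (∀ {x y} (x∈ : x ∈ xs) (y∈ : y ∈ xs) → R x y → S (f x∈) (f y∈)) → AllPairs R xs → AllPairs S (mapWith∈ xs f)
allPairs-mapWith∈ []       f pres []         = []
allPairs-mapWith∈ {R = R} {S} (x ∷ xs) f pres (Rx ∷ Rxs) =
  heads xs (λ y∈ → there y∈) Rx ∷ allPairs-mapWith∈ xs (λ x∈ → f (there x∈)) (λ x∈ y∈ → pres (there x∈) (there y∈)) Rxs
  where
  heads : ∀ ys (emb : ∀ {y} → y ∈ ys → y ∈ x ∷ xs) → All (R x) ys → All (S (f (here refl))) (mapWith∈ ys (λ y∈ → f (emb y∈)))
  heads []       emb []         = []
  heads (y ∷ ys) emb (Rxy ∷ Rx′) = pres (here refl) (emb (here refl)) Rxy ∷ heads ys (λ y∈ → emb (there y∈)) Rx′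

-- Connection sets of ℤₙ

module ConnectionSets (m : ℕ) where

  n : ℕ
  n = suc m

  Symmetric : Subset n → Set
  Symmetric Ω = ∀ g → g Sub.∈ Ω → (⊝ g) Sub.∈ Ω

  toℕ-⊕ : ∀ (i j : Fin n) → toℕ (i ⊕ j) ≡ (toℕ i ℕ.+ toℕ j) % n
  toℕ-⊕ i j = FinP.toℕ-fromℕ< _

  toℕ-⊝ : ∀ (i : Fin n) → toℕ (⊝ i) ≡ (n ∸ toℕ i) % n
  toℕ-⊝ i = FinP.toℕ-fromℕ< _

  %n-id : ∀ {x} → x < n → x % n ≡ x
  %n-id = DM.m<n⇒m%n≡m

  ⊕-identityʳ : ∀ (i : Fin n) → i ⊕ Fin.zero ≡ i
  ⊕-identityʳ i = FinP.toℕ-injective (trans (toℕ-⊕ i Fin.zero)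
    (trans (cong (_% n) (ℕP.+-identityʳ (toℕ i))) (%n-id (FinP.toℕ<n i))))

  ⊖-identityʳ : ∀ (i : Fin n) → i ⊖ Fin.zero ≡ i
  ⊖-identityʳ i = trans (cong (i ⊕_) (FinP.toℕ-injective (trans (toℕ-⊝ Fin.zero) (DM.n%n≡0 n)))) (⊕-identityʳ i)

  ⊕-⊖-cancel : ∀ (h c : Fin n) → (h ⊕ c) ⊖ c ≡ h
  ⊕-⊖-cancel h c = FinP.toℕ-injective (begin
    toℕ ((h ⊕ c) ⊕ (⊝ c))                              ≡⟨ toℕ-⊕ (h ⊕ c) (⊝ c) ⟩
    (toℕ (h ⊕ c) ℕ.+ toℕ (⊝ c)) % n                    ≡⟨ cong₂ (λ a b → (a ℕ.+ b) % n) (toℕ-⊕ h c) (toℕ-⊝ c) ⟩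
    ((toℕ h ℕ.+ toℕ c) % n ℕ.+ (n ∸ toℕ c) % n) % n    ≡⟨ sym (DM.%-distribˡ-+ (toℕ h ℕ.+ toℕ c) (n ∸ toℕ c) n) ⟩
    (toℕ h ℕ.+ toℕ c ℕ.+ (n ∸ toℕ c)) % n              ≡⟨ cong (_% n) (trans (ℕP.+-assoc (toℕ h) (toℕ c) _)
                                                            (cong (toℕ h ℕ.+_) (ℕP.m+[n∸m]≡n (ℕP.<⇒≤ (FinP.toℕ<n c))))) ⟩
    (toℕ h ℕ.+ n) % n                                  ≡⟨ DM.[m+n]%n≡m%n (toℕ h) n ⟩
    toℕ h % n                                          ≡⟨ %n-id (FinP.toℕ<n h) ⟩
    toℕ h                                              ∎)
    where open ≡-Reasoning

  -- An equivariant f is a translation, so comparing adjacency with 0 compares Ω and Ω' elementwise.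
  equivalent⇒≡ : ∀ {Ω Ω′ : Subset n} → Equivalent Ω Ω′ → Ω ≡ Ω′
  equivalent⇒≡ {Ω} {Ω′} (f , _ , adj , equivariant) = SubP.⊆-antisym
    (λ {h} h∈Ω → subst (Sub._∈ Ω′) (f-shift h) (Equivalence.to (adj Fin.zero h) (subst (Sub._∈ Ω) (sym (⊖-identityʳ h)) h∈Ω)))
    (λ {h} h∈Ω′ → subst (Sub._∈ Ω) (⊖-identityʳ h) (Equivalence.from (adj Fin.zero h) (subst (Sub._∈ Ω′) (sym (f-shift h)) h∈Ω′)))
    where
    f-shift : ∀ h → f h ⊖ f Fin.zero ≡ h
    f-shift h = trans (cong (_⊖ f Fin.zero) (trans (cong f (sym (⊕-identityʳ h))) (equivariant h Fin.zero)))
                      (⊕-⊖-cancel h (f Fin.zero))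

  GeneratedResidue : Subset n → ℕ → Set
  GeneratedResidue Ω a = Σ (Fin n) λ g → toℕ g ≡ a % n × Generated Ω g

  residue-0 : ∀ {Ω} → GeneratedResidue Ω 0
  residue-0 = Fin.zero , refl , zro

  residue-+ : ∀ {Ω} a b → GeneratedResidue Ω a → GeneratedResidue Ω b → GeneratedResidue Ω (a ℕ.+ b)
  residue-+ a b (g , g≡a , gen-g) (g′ , g′≡b , gen-g′) = g ⊕ g′ ,
    trans (toℕ-⊕ g g′) (trans (cong₂ (λ x y → (x ℕ.+ y) % n) g≡a g′≡b) (sym (DM.%-distribˡ-+ a b n))) ,
    add gen-g gen-g′

  residue-* : ∀ {Ω} a c → GeneratedResidue Ω a → GeneratedResidue Ω (c ℕ.* a)
  residue-* a zero    _     = residue-0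
  residue-* a (suc c) gen-a = residue-+ a (c ℕ.* a) gen-a (residue-* a c gen-a)

  residue-sub : ∀ {Ω a b d} → d ℕ.+ a ≡ b → GeneratedResidue Ω a → GeneratedResidue Ω b → GeneratedResidue Ω d
  residue-sub {Ω} {a} {b} {d} d+a≡b (g , g≡a , gen-g) gen-b with residue-+ b (n ∸ a % n) gen-b (⊝ g , trans (toℕ-⊝ g) (cong (λ z → (n ∸ z) % n) g≡a) , neg gen-g)
  ... | g″ , g″≡ , gen-g″ = g″ , trans g″≡ b-a≡d , gen-g″
    where
    open ≡-Reasoning
    a+[n∸a%n]≡ : a ℕ.+ (n ∸ a % n) ≡ suc (a / n) ℕ.* n
    a+[n∸a%n]≡ = begin
      a ℕ.+ (n ∸ a % n)                           ≡⟨ cong (ℕ._+ (n ∸ a % n)) (trans (DM.m≡m%n+[m/n]*n a n) (ℕP.+-comm (a % n) _)) ⟩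
      a / n ℕ.* n ℕ.+ a % n ℕ.+ (n ∸ a % n)       ≡⟨ ℕP.+-assoc (a / n ℕ.* n) (a % n) _ ⟩
      a / n ℕ.* n ℕ.+ (a % n ℕ.+ (n ∸ a % n))     ≡⟨ cong (a / n ℕ.* n ℕ.+_) (ℕP.m+[n∸m]≡n (DM.m%n≤n a n)) ⟩
      a / n ℕ.* n ℕ.+ n                           ≡⟨ ℕP.+-comm (a / n ℕ.* n) n ⟩
      suc (a / n) ℕ.* n                           ∎
    b-a≡d : (b ℕ.+ (n ∸ a % n)) % n ≡ d % n
    b-a≡d = begin
      (b ℕ.+ (n ∸ a % n)) % n          ≡⟨ cong (λ z → (z ℕ.+ (n ∸ a % n)) % n) (sym d+a≡b) ⟩
      (d ℕ.+ a ℕ.+ (n ∸ a % n)) % n    ≡⟨ cong (_% n) (trans (ℕP.+-assoc d a _) (cong (d ℕ.+_) a+[n∸a%n]≡)) ⟩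
      (d ℕ.+ suc (a / n) ℕ.* n) % n    ≡⟨ DM.[m+kn]%n≡m%n d (suc (a / n)) n ⟩
      d % n                            ∎

  half : ℕ
  half = n / 2

  half+half≤n : half ℕ.+ half ≤ n
  half+half≤n = subst (_≤ n) (*2≡+ half) (DM.m/n*n≤m n 2)

  n≤1+half+half : n ≤ suc (half ℕ.+ half)
  n≤1+half+half = subst (_≤ suc (half ℕ.+ half)) (sym (DM.m≡m%n+[m/n]*n n 2))
    (subst (λ z → n % 2 ℕ.+ half ℕ.* 2 ≤ suc z) (*2≡+ half) (ℕP.+-monoˡ-≤ (half ℕ.* 2) (ℕP.≤-pred (DM.m%n<n n 2))))

  InHalf : List ℕ → Set
  InHalf T = ∀ {j} → j ∈ T → j ∈ halfRange n

  ∈halfRange⇒≤half : ∀ {j} → j ∈ halfRange n → j ≤ half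
  ∈halfRange⇒≤half j∈ = proj₂ (∈-range1⁻ j∈)

  ∈halfRange⇒≥1 : ∀ {j} → j ∈ halfRange n → 1 ≤ j
  ∈halfRange⇒≥1 j∈ = proj₁ (∈-range1⁻ j∈)

  ∈halfRange⇒<n : ∀ {j} → j ∈ halfRange n → j < n
  ∈halfRange⇒<n j∈ = ℕP.≤-<-trans (∈halfRange⇒≤half j∈) (DM.m/n<m n 2 (s≤s (s≤s z≤n)))

  ∈halfRange⇒n∸<n : ∀ {j} → j ∈ halfRange n → n ∸ j < n
  ∈halfRange⇒n∸<n j∈ = ℕP.∸-monoʳ-< (∈halfRange⇒≥1 j∈) (ℕP.<⇒≤ (∈halfRange⇒<n j∈))

  halves-sum-to-n : ∀ {t j} → t ≤ half → j ≤ half → t ℕ.+ j ≡ n → t ≡ j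
  halves-sum-to-n {t} {j} t≤h j≤h t+j≡n = trans t≡h (sym j≡h)
    where
    t+j≡h+h = ℕP.≤-antisym (ℕP.+-mono-≤ t≤h j≤h) (subst (half ℕ.+ half ≤_) (sym t+j≡n) half+half≤n)
    t≡h = ℕP.≤-antisym t≤h (ℕP.≮⇒≥ (λ t<h → ℕP.<-irrefl t+j≡h+h (ℕP.+-mono-<-≤ t<h j≤h)))
    j≡h = ℕP.≤-antisym j≤h (ℕP.≮⇒≥ (λ j<h → ℕP.<-irrefl t+j≡h+h (ℕP.+-mono-≤-< t≤h j<h)))

  -- A symmetric Ω ⊆ ℤₙ ∖ {0} is encoded by T = Ω ∩ [1, n/2]; it is recovered as T ∪ (n − T).
  pairOf : ℕ → ℕ → Bool
  pairOf j x = (x ≡ᵇ j) ∨ (x ≡ᵇ n ∸ j)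

  covers : List ℕ → ℕ → Bool
  covers []      x = false
  covers (j ∷ T) x = pairOf j x ∨ covers T x

  connectionSet : List ℕ → Subset n
  connectionSet T = tabulate (λ i → covers T (toℕ i))

  pairOf⇒ : ∀ j x → pairOf j x ≡ true → x ≡ j ⊎ x ≡ n ∸ j
  pairOf⇒ j x x∈ with x ≡ᵇ j in x≡j
  ... | true  = inj₁ (≡ᵇ⇒≡ x≡j)
  ... | false = inj₂ (≡ᵇ⇒≡ x∈)

  covers⇒ : ∀ T x → covers T x ≡ true → ∃ λ j → j ∈ T × (x ≡ j ⊎ x ≡ n ∸ j)
  covers⇒ (j ∷ T) x cov with pairOf j x in pj
  ... | true  = j , here refl , pairOf⇒ j x pj
  ... | false = let (k , k∈ , x≡) = covers⇒ T x cov in k , there k∈ , x≡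

  covers⇐ : ∀ T x {j} → j ∈ T → x ≡ j ⊎ x ≡ n ∸ j → covers T x ≡ true
  covers⇐ (j ∷ T) x (here refl) (inj₁ refl) rewrite ≡ᵇ-true {x} refl = refl
  covers⇐ (j ∷ T) x (here refl) (inj₂ refl) rewrite ≡ᵇ-true {x} refl | BoolP.∨-zeroʳ (x ≡ᵇ j) = refl
  covers⇐ (t ∷ T) x (there j∈) x≡ rewrite covers⇐ T x j∈ x≡ = BoolP.∨-zeroʳ _

  covers⇒bounds : ∀ T x → InHalf T → covers T x ≡ true → 1 ≤ x × x < n
  covers⇒bounds T x T-half cov with covers⇒ T x cov
  ... | j , j∈ , inj₁ refl = ∈halfRange⇒≥1 (T-half j∈) , ∈halfRange⇒<n (T-half j∈)
  ... | j , j∈ , inj₂ refl = ℕP.m<n⇒0<n∸m (∈halfRange⇒<n (T-half j∈)) , ∈halfRange⇒n∸<n (T-half j∈)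

  lookup-connectionSet : ∀ T i → lookup (connectionSet T) i ≡ covers T (toℕ i)
  lookup-connectionSet T i = VecP.lookup∘tabulate (λ i → covers T (toℕ i)) i

  ∈connectionSet⇒covers : ∀ T {i} → i Sub.∈ connectionSet T → covers T (toℕ i) ≡ true
  ∈connectionSet⇒covers T {i} i∈ = trans (sym (lookup-connectionSet T i)) (VecP.[]=⇒lookup i∈)

  covers⇒∈connectionSet : ∀ T {i} → covers T (toℕ i) ≡ true → i Sub.∈ connectionSet T
  covers⇒∈connectionSet T {i} cov = VecP.lookup⇒[]= i (connectionSet T) (trans (lookup-connectionSet T i) cov)

  connectionSet-symmetric : ∀ T → InHalf T → Symmetric (connectionSet T)
  connectionSet-symmetric T T-half g g∈ = covers⇒∈connectionSet T (subst (λ z → covers T z ≡ true) (sym toℕ-⊝g) n∸x-covered)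
    where
    x = toℕ g
    cov = ∈connectionSet⇒covers T g∈
    bounds = covers⇒bounds T x T-half cov
    toℕ-⊝g : toℕ (⊝ g) ≡ n ∸ x
    toℕ-⊝g = trans (toℕ-⊝ g) (%n-id (ℕP.∸-monoʳ-< (proj₁ bounds) (ℕP.<⇒≤ (proj₂ bounds))))
    n∸x-covered : covers T (n ∸ x) ≡ true
    n∸x-covered with covers⇒ T x cov
    ... | j , j∈ , inj₁ x≡j   = covers⇐ T (n ∸ x) j∈ (inj₂ (cong (n ∸_) x≡j))
    ... | j , j∈ , inj₂ x≡n∸j = covers⇐ T (n ∸ x) j∈
          (inj₁ (trans (cong (n ∸_) x≡n∸j) (ℕP.m∸[m∸n]≡n (ℕP.<⇒≤ (∈halfRange⇒<n (T-half j∈))))))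

  0∉connectionSet : ∀ T → InHalf T → ¬ Fin.zero Sub.∈ connectionSet T
  0∉connectionSet T T-half 0∈ = ℕP.<-irrefl refl (proj₁ (covers⇒bounds T 0 T-half (∈connectionSet⇒covers T 0∈)))

  ∣-%n : ∀ {G x} → G ∣ n → G ∣ x → G ∣ x % n
  ∣-%n {G} {x} G∣n G∣x = ∣m+n∣m⇒∣n (subst (G ∣_) (trans (DM.m≡m%n+[m/n]*n x n) (ℕP.+-comm (x % n) _)) G∣x) (∣-trans G∣n (n∣m*n (x / n)))

  ∣-n∸ : ∀ {G j} → G ∣ n → G ∣ j → j ≤ n → G ∣ n ∸ j
  ∣-n∸ {G} {j} G∣n G∣j j≤n = ∣m+n∣m⇒∣n (subst (G ∣_) (sym (ℕP.m+[n∸m]≡n j≤n)) G∣n) G∣j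

  generated⇒gcd∣ : ∀ T → InHalf T → ∀ {g} → Generated (connectionSet T) g → gcdWith n T ∣ toℕ g
  generated⇒gcd∣ T T-half (base {g} g∈) with covers⇒ T (toℕ g) (∈connectionSet⇒covers T g∈)
  ... | j , j∈ , inj₁ g≡j   = subst (gcdWith n T ∣_) (sym g≡j) (gcdWith∣∈ n T j∈)
  ... | j , j∈ , inj₂ g≡n∸j = subst (gcdWith n T ∣_) (sym g≡n∸j)
                               (∣-n∸ (gcdWith∣n n T) (gcdWith∣∈ n T j∈) (ℕP.<⇒≤ (∈halfRange⇒<n (T-half j∈))))
  generated⇒gcd∣ T T-half zro = _ ∣0
  generated⇒gcd∣ T T-half (add {g} {g′} gen-g gen-g′) = subst (gcdWith n T ∣_) (sym (toℕ-⊕ g g′))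
    (∣-%n (gcdWith∣n n T) (∣m∣n⇒∣m+n (generated⇒gcd∣ T T-half gen-g) (generated⇒gcd∣ T T-half gen-g′)))
  generated⇒gcd∣ T T-half (neg {g} gen-g) = subst (gcdWith n T ∣_) (sym (toℕ-⊝ g))
    (∣-%n (gcdWith∣n n T) (∣-n∸ (gcdWith∣n n T) (generated⇒gcd∣ T T-half gen-g) (ℕP.<⇒≤ (FinP.toℕ<n g))))

  generating⇒gcd≡1 : ∀ T → InHalf T → (∀ g → Generated (connectionSet T) g) → gcdWith n T ≡ 1
  generating⇒gcd≡1 T T-half generating with 2 ≤? n
  ... | no  n≱2 = ∣1⇒≡1 (subst (gcdWith n T ∣_) (ℕP.≤-antisym (ℕP.≤-pred (ℕP.≰⇒> n≱2)) (s≤s z≤n)) (gcdWith∣n n T))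
  ... | yes n≥2 = ∣1⇒≡1 (subst (gcdWith n T ∣_) (FinP.toℕ-fromℕ< n≥2) (generated⇒gcd∣ T T-half (generating (fromℕ< n≥2))))

  -- By Bézout, gcd(j, g′) + y g′ = x j or gcd(j, g′) + x j = y g′: a difference of generated residues.
  gcd-residue : ∀ T → InHalf T → ∀ S → (∀ {j} → j ∈ S → j ∈ T) → GeneratedResidue (connectionSet T) (gcdWith n S)
  gcd-residue T T-half []      _    = Fin.zero , sym (DM.n%n≡0 n) , zro
  gcd-residue T T-half (j ∷ S) S⊆T = combine (Bézout.identity (gcd-GCD j g′))
    where
    Ω = connectionSet T
    g′ = gcdWith n S
    gen-g′ = gcd-residue T T-half S (λ k∈ → S⊆T (there k∈))
    j∈T = S⊆T (here refl)
    j<n = ∈halfRange⇒<n (T-half j∈T)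
    gen-j : GeneratedResidue Ω j
    gen-j = fromℕ< j<n , trans (FinP.toℕ-fromℕ< j<n) (sym (%n-id j<n)) ,
            base (covers⇒∈connectionSet T (subst (λ z → covers T z ≡ true) (sym (FinP.toℕ-fromℕ< j<n)) (covers⇐ T j j∈T (inj₁ refl))))
    combine : Bézout.Identity (gcd j g′) j g′ → GeneratedResidue Ω (gcd j g′)
    combine (Bézout.+- x y eq) = residue-sub {a = y ℕ.* g′} {b = x ℕ.* j} eq (residue-* g′ y gen-g′) (residue-* j x gen-j)
    combine (Bézout.-+ x y eq) = residue-sub {a = x ℕ.* j} {b = y ℕ.* g′} eq (residue-* j x gen-j) (residue-* g′ y gen-g′)

  gcd≡1⇒generating : ∀ T → InHalf T → gcdWith n T ≡ 1 → ∀ g → Generated (connectionSet T) g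
  gcd≡1⇒generating T T-half gcd≡1 g with residue-* 1 (toℕ g) (subst (GeneratedResidue (connectionSet T)) gcd≡1 (gcd-residue T T-half T (λ j∈ → j∈)))
  ... | g′ , g′≡g , gen-g′ = subst (Generated (connectionSet T))
        (FinP.toℕ-injective (trans g′≡g (trans (cong (_% n) (ℕP.*-identityʳ (toℕ g))) (%n-id (FinP.toℕ<n g))))) gen-g′

  connectionSet-admissible : ∀ T → InHalf T → gcdWith n T ≡ 1 → Admissible (connectionSet T)
  connectionSet-admissible T T-half gcd≡1 =
    connectionSet-symmetric T T-half , 0∉connectionSet T T-half , gcd≡1⇒generating T T-half gcd≡1

  pairs-disjoint : ∀ {t j x} → t ∈ halfRange n → j ∈ halfRange n → x ≡ t ⊎ x ≡ n ∸ t → x ≡ j ⊎ x ≡ n ∸ j → t ≡ j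
  pairs-disjoint t∈ j∈ (inj₁ refl) (inj₁ refl) = refl
  pairs-disjoint {t} {j} t∈ j∈ (inj₁ refl) (inj₂ t≡n∸j) = halves-sum-to-n (∈halfRange⇒≤half t∈) (∈halfRange⇒≤half j∈)
    (trans (cong (ℕ._+ j) t≡n∸j) (trans (ℕP.+-comm (n ∸ j) j) (ℕP.m+[n∸m]≡n (ℕP.<⇒≤ (∈halfRange⇒<n j∈)))))
  pairs-disjoint {t} {j} t∈ j∈ (inj₂ j≡n∸t) (inj₁ refl) = sym (halves-sum-to-n (∈halfRange⇒≤half j∈) (∈halfRange⇒≤half t∈)
    (trans (cong (ℕ._+ t) j≡n∸t) (trans (ℕP.+-comm (n ∸ t) t) (ℕP.m+[n∸m]≡n (ℕP.<⇒≤ (∈halfRange⇒<n t∈))))))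
  pairs-disjoint t∈ j∈ (inj₂ x≡n∸t) (inj₂ x≡n∸j) =
    ℕP.∸-cancelˡ-≡ (ℕP.<⇒≤ (∈halfRange⇒<n t∈)) (ℕP.<⇒≤ (∈halfRange⇒<n j∈)) (trans (sym x≡n∸t) x≡n∸j)

  ∑-pairOf : ∀ {t} → t ∈ halfRange n → ∑[ x ∈ range 0 n ] when (pairOf t x) 1ℤ ≡ + weight n t
  ∑-pairOf {t} t∈ with t ℕ.+ t ≟ n
  ... | yes t+t≡n rewrite ≡ᵇ-true t+t≡n = begin
    ∑[ x ∈ range 0 n ] when ((x ≡ᵇ t) ∨ (x ≡ᵇ n ∸ t)) 1ℤ
      ≡⟨ ∑-cong (range 0 n) (λ x → cong (λ b → when b 1ℤ) (trans (cong (λ z → (x ≡ᵇ t) ∨ (x ≡ᵇ z)) n∸t≡t) (BoolP.∨-idem (x ≡ᵇ t)))) ⟩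
    ∑[ x ∈ range 0 n ] when (x ≡ᵇ t) 1ℤ
      ≡⟨ ∑-range-indicator 0 n t (λ _ → 1ℤ) z≤n (∈halfRange⇒<n t∈) ⟩
    1ℤ ∎
    where
    open ≡-Reasoning
    n∸t≡t = trans (cong (_∸ t) (sym t+t≡n)) (ℕP.m+n∸n≡m t t)
  ... | no t+t≢n rewrite ≡ᵇ-false t+t≢n = begin
    ∑[ x ∈ range 0 n ] when ((x ≡ᵇ t) ∨ (x ≡ᵇ n ∸ t)) 1ℤ
      ≡⟨ ∑-cong (range 0 n) (λ x → when-∨ (x ≡ᵇ t) (x ≡ᵇ n ∸ t) (distinct x)) ⟩
    ∑[ x ∈ range 0 n ] (when (x ≡ᵇ t) 1ℤ + when (x ≡ᵇ n ∸ t) 1ℤ)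
      ≡⟨ ∑-+ (range 0 n) (λ x → when (x ≡ᵇ t) 1ℤ) (λ x → when (x ≡ᵇ n ∸ t) 1ℤ) ⟩
    ∑[ x ∈ range 0 n ] when (x ≡ᵇ t) 1ℤ + ∑[ x ∈ range 0 n ] when (x ≡ᵇ n ∸ t) 1ℤ
      ≡⟨ cong₂ _+_ (∑-range-indicator 0 n t (λ _ → 1ℤ) z≤n (∈halfRange⇒<n t∈))
                   (∑-range-indicator 0 n (n ∸ t) (λ _ → 1ℤ) z≤n (∈halfRange⇒n∸<n t∈)) ⟩
    + 2 ∎
    where
    open ≡-Reasoning
    distinct : ∀ x → (x ≡ᵇ t) ≡ true → (x ≡ᵇ n ∸ t) ≡ true → ⊥
    distinct x x≡t x≡n∸t = t+t≢n (trans (cong (t ℕ.+_) (trans (sym (≡ᵇ⇒≡ {x} {t} x≡t)) (≡ᵇ⇒≡ {x} {n ∸ t} x≡n∸t)))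
                                        (ℕP.m+[n∸m]≡n (ℕP.<⇒≤ (∈halfRange⇒<n t∈))))

  ∑-covers : ∀ T → InHalf T → Unique T → ∑[ x ∈ range 0 n ] when (covers T x) 1ℤ ≡ + weightSum (weight n) T
  ∑-covers []      _      _          = ∑-zero (range 0 n) _ (λ _ _ → refl)
  ∑-covers (t ∷ T) T-half (t∉ ∷ uT) = begin
    ∑[ x ∈ range 0 n ] when (pairOf t x ∨ covers T x) 1ℤ
      ≡⟨ ∑-cong (range 0 n) (λ x → when-∨ (pairOf t x) (covers T x) (disjoint x)) ⟩
    ∑[ x ∈ range 0 n ] (when (pairOf t x) 1ℤ + when (covers T x) 1ℤ)
      ≡⟨ ∑-+ (range 0 n) (λ x → when (pairOf t x) 1ℤ) (λ x → when (covers T x) 1ℤ) ⟩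
    ∑[ x ∈ range 0 n ] when (pairOf t x) 1ℤ + ∑[ x ∈ range 0 n ] when (covers T x) 1ℤ
      ≡⟨ cong₂ _+_ (∑-pairOf (T-half (here refl))) (∑-covers T (λ j∈ → T-half (there j∈)) uT) ⟩
    + weightSum (weight n) (t ∷ T) ∎
    where
    open ≡-Reasoning
    disjoint : ∀ x → pairOf t x ≡ true → covers T x ≡ true → ⊥
    disjoint x x∈t cov with covers⇒ T x cov
    ... | j , j∈ , x≡ = All¬⇒¬Any t∉ (subst (_∈ T) (sym (pairs-disjoint (T-half (here refl)) (T-half (there j∈)) (pairOf⇒ t x x∈t) x≡)) j∈)

  ∣connectionSet∣ : ∀ T → InHalf T → Unique T → ∣ connectionSet T ∣ ≡ weightSum (weight n) T
  ∣connectionSet∣ T T-half uT = ℤP.+-injective (trans (∣tabulate∣≡∑ n (covers T)) (∑-covers T T-half uT))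

  memberℕ : Subset n → ℕ → Bool
  memberℕ Ω j with j ℕ.<? n
  ... | yes j<n = lookup Ω (fromℕ< j<n)
  ... | no  _   = false

  memberℕ-< : ∀ Ω {j} (j<n : j < n) → memberℕ Ω j ≡ lookup Ω (fromℕ< j<n)
  memberℕ-< Ω {j} j<n with j ℕ.<? n
  ... | yes j<n′ = cong (lookup Ω) (FinP.fromℕ<-cong j j refl j<n′ j<n)
  ... | no  j≮n  = ⊥-elim (j≮n j<n)

  memberℕ-toℕ : ∀ Ω i → memberℕ Ω (toℕ i) ≡ lookup Ω i
  memberℕ-toℕ Ω i = trans (memberℕ-< Ω (FinP.toℕ<n i)) (cong (lookup Ω) (FinP.fromℕ<-toℕ i (FinP.toℕ<n i)))

  memberℕ-connectionSet : ∀ T {j} → j < n → memberℕ (connectionSet T) j ≡ covers T j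
  memberℕ-connectionSet T j<n = trans (memberℕ-< (connectionSet T) j<n)
    (trans (lookup-connectionSet T (fromℕ< j<n)) (cong (covers T) (FinP.toℕ-fromℕ< j<n)))

  halfOf : Subset n → List ℕ
  halfOf Ω = List.filterᵇ (memberℕ Ω) (halfRange n)

  halfOf-connectionSet : ∀ {T} → T ∈ sublists (halfRange n) → halfOf (connectionSet T) ≡ T
  halfOf-connectionSet {T} T∈ = filter-recovers-sublist (halfRange n) T (memberℕ (connectionSet T)) (unique-range 1 half) T∈
    (λ j∈ → mk⇔ (covered⇒∈ j∈) (λ j∈T → trans (memberℕ-connectionSet T (∈halfRange⇒<n j∈)) (covers⇐ T _ j∈T (inj₁ refl))))
    where
    covered⇒∈ : ∀ {j} → j ∈ halfRange n → memberℕ (connectionSet T) j ≡ true → j ∈ T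
    covered⇒∈ {j} j∈ mem with covers⇒ T j (trans (sym (memberℕ-connectionSet T (∈halfRange⇒<n j∈))) mem)
    ... | t , t∈T , inj₁ refl   = t∈T
    ... | t , t∈T , inj₂ j≡n∸t = subst (_∈ T) (halves-sum-to-n (∈halfRange⇒≤half t∈) (∈halfRange⇒≤half j∈)
                                    (trans (cong (t ℕ.+_) j≡n∸t) (ℕP.m+[n∸m]≡n (ℕP.<⇒≤ (∈halfRange⇒<n t∈))))) t∈T
      where t∈ = ∈-sublists⇒⊆ T∈ t∈T

  connectionSet-injective : ∀ {T T′} → T ∈ sublists (halfRange n) → T′ ∈ sublists (halfRange n) →
                            connectionSet T ≡ connectionSet T′ → T ≡ T′
  connectionSet-injective T∈ T′∈ eq = trans (sym (halfOf-connectionSet T∈)) (trans (cong halfOf eq) (halfOf-connectionSet T′∈))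

  ∈⇒memberℕ : ∀ {Ω i} → i Sub.∈ Ω → memberℕ Ω (toℕ i) ≡ true
  ∈⇒memberℕ {Ω} {i} i∈ = trans (memberℕ-toℕ Ω i) (VecP.[]=⇒lookup i∈)

  memberℕ⇒∈ : ∀ {Ω j} (j<n : j < n) → memberℕ Ω j ≡ true → fromℕ< j<n Sub.∈ Ω
  memberℕ⇒∈ {Ω} j<n mem = VecP.lookup⇒[]= (fromℕ< j<n) Ω (trans (sym (memberℕ-< Ω j<n)) mem)

  ∈halfOf⇒ : ∀ {Ω j} → j ∈ halfOf Ω → j ∈ halfRange n × memberℕ Ω j ≡ true
  ∈halfOf⇒ {Ω} j∈ with ∈-filter⁻ (λ j → T? (memberℕ Ω j)) {xs = halfRange n} j∈
  ... | j∈half , mem = j∈half , Equivalence.to BoolP.T-≡ mem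

  ∈halfOf⇐ : ∀ {Ω j} → j ∈ halfRange n → memberℕ Ω j ≡ true → j ∈ halfOf Ω
  ∈halfOf⇐ {Ω} j∈ mem = ∈-filter⁺ (λ j → T? (memberℕ Ω j)) j∈ (Equivalence.from BoolP.T-≡ mem)

  connectionSet-halfOf-⊆ : ∀ {Ω} → Symmetric Ω → connectionSet (halfOf Ω) Sub.⊆ Ω
  connectionSet-halfOf-⊆ {Ω} symmetric {i} i∈ with covers⇒ (halfOf Ω) (toℕ i) (∈connectionSet⇒covers (halfOf Ω) i∈)
  ... | j , j∈ , i≡ with ∈halfOf⇒ {Ω} j∈
  ... | j∈half , mem with i≡
  ...   | inj₁ i≡j   = subst (Sub._∈ Ω) (FinP.toℕ-injective (trans (FinP.toℕ-fromℕ< j<n) (sym i≡j))) (memberℕ⇒∈ j<n mem)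
    where j<n = ∈halfRange⇒<n j∈half
  ...   | inj₂ i≡n∸j = subst (Sub._∈ Ω) ⊝j≡i (symmetric _ (memberℕ⇒∈ j<n mem))
    where
    j<n = ∈halfRange⇒<n j∈half
    ⊝j≡i : ⊝ fromℕ< j<n ≡ i
    ⊝j≡i = FinP.toℕ-injective (trans (toℕ-⊝ (fromℕ< j<n))
             (trans (cong (λ z → (n ∸ z) % n) (FinP.toℕ-fromℕ< j<n)) (trans (%n-id (∈halfRange⇒n∸<n j∈half)) (sym i≡n∸j))))

  ∈⇒toℕ≥1 : ∀ {Ω : Subset n} {i} → ¬ Fin.zero Sub.∈ Ω → i Sub.∈ Ω → 1 ≤ toℕ i
  ∈⇒toℕ≥1 {Ω} {i} 0∉Ω i∈ with toℕ i in toℕi≡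
  ... | zero  = ⊥-elim (0∉Ω (subst (Sub._∈ Ω) (FinP.toℕ-injective toℕi≡) i∈))
  ... | suc _ = s≤s z≤n

  n∸x≤half : ∀ {x} → half < x → n ∸ x ≤ half
  n∸x≤half half<x = ℕP.≤-trans (ℕP.∸-monoʳ-≤ n half<x)
    (ℕP.≤-trans (ℕP.∸-monoˡ-≤ (suc half) n≤1+half+half)
                (ℕP.≤-reflexive (trans (cong (_∸ half) (ℕP.+-comm half half)) (ℕP.m+n∸n≡m half half))))

  ⊆-connectionSet-halfOf : ∀ {Ω} → Symmetric Ω → ¬ Fin.zero Sub.∈ Ω → Ω Sub.⊆ connectionSet (halfOf Ω)
  ⊆-connectionSet-halfOf {Ω} symmetric 0∉Ω {i} i∈ = covers⇒∈connectionSet (halfOf Ω) covered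
    where
    x = toℕ i
    covered : covers (halfOf Ω) x ≡ true
    covered with x ≤? half
    ... | yes x≤h = covers⇐ (halfOf Ω) x (∈halfOf⇐ {Ω} (∈-range⁺ 1 half (∈⇒toℕ≥1 0∉Ω i∈) (s≤s x≤h)) (∈⇒memberℕ i∈)) (inj₁ refl)
    ... | no  x≰h = covers⇐ (halfOf Ω) x (∈halfOf⇐ {Ω} (∈-range⁺ 1 half 1≤n∸x (s≤s (n∸x≤half (ℕP.≰⇒> x≰h)))) n∸x-member)
                      (inj₂ (sym (ℕP.m∸[m∸n]≡n (ℕP.<⇒≤ (FinP.toℕ<n i)))))
      where
      1≤n∸x = ℕP.m<n⇒0<n∸m (FinP.toℕ<n i)
      toℕ-⊝i : toℕ (⊝ i) ≡ n ∸ x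
      toℕ-⊝i = trans (toℕ-⊝ i) (%n-id (ℕP.∸-monoʳ-< (∈⇒toℕ≥1 0∉Ω i∈) (ℕP.<⇒≤ (FinP.toℕ<n i))))
      n∸x-member : memberℕ Ω (n ∸ x) ≡ true
      n∸x-member = trans (cong (memberℕ Ω) (sym toℕ-⊝i)) (∈⇒memberℕ (symmetric i i∈))

  connectionSet-halfOf : ∀ {Ω} → Admissible Ω → connectionSet (halfOf Ω) ≡ Ω
  connectionSet-halfOf (symmetric , 0∉Ω , _) =
    SubP.⊆-antisym (connectionSet-halfOf-⊆ symmetric) (⊆-connectionSet-halfOf symmetric 0∉Ω)

  ∣connectionSet∣-sublist : ∀ {T} → T ∈ sublists (halfRange n) → ∣ connectionSet T ∣ ≡ weightSum (weight n) T
  ∣connectionSet∣-sublist {T} T∈ = ∣connectionSet∣ T (∈-sublists⇒⊆ T∈) (∈-sublists⇒unique (unique-range 1 half) T∈)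

  ∣connectionSet∣≤m : ∀ T → InHalf T → ∣ connectionSet T ∣ ≤ m
  ∣connectionSet∣≤m T T-half with covers T 0 in cov0
  ... | true  = ⊥-elim (ℕP.<-irrefl refl (proj₁ (covers⇒bounds T 0 T-half cov0)))
  ... | false = SubP.∣p∣≤n (tabulate (λ i → covers T (toℕ (Fin.suc i))))

  weightSum≤m : ∀ {T} → T ∈ sublists (halfRange n) → weightSum (weight n) T ≤ m
  weightSum≤m {T} T∈ = subst (_≤ m) (∣connectionSet∣-sublist T∈) (∣connectionSet∣≤m T (∈-sublists⇒⊆ T∈))

  equivalent-refl : ∀ (Ω : Subset n) → Equivalent Ω Ω
  equivalent-refl Ω = (λ g → g) , Identity.bijective _≡_ , (λ g h → Identity.⇔-id _) , (λ g u → refl)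

  module Representatives {P : ℕ → Set} (P? : ∀ w → Dec (P w)) where

    good : List ℕ → Bool
    good T = (gcdWith n T ≡ᵇ 1) ∧ does (P? (weightSum (weight n) T))

    goodHalves : List (List ℕ)
    goodHalves = List.filterᵇ good (sublists (halfRange n))

    good⇒conditions : ∀ {T} → T ∈ goodHalves → Admissible (connectionSet T) × P ∣ connectionSet T ∣
    good⇒conditions {T} T∈ with ∈-filter⁻ (λ T → T? (good T)) {xs = sublists (halfRange n)} T∈
    ... | T∈sub , goodT with Equivalence.to BoolP.T-∧ goodT
    ... | gcd≡1 , P-weight =
      connectionSet-admissible T (∈-sublists⇒⊆ T∈sub) (ℕP.≡ᵇ⇒≡ _ 1 gcd≡1) ,
      subst P (sym (∣connectionSet∣-sublist T∈sub)) (T-does⁻ (P? _) P-weight)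

    toCayley : ∀ {T} → T ∈ goodHalves → CayleyOf {m} (λ Ω → P ∣ Ω ∣)
    toCayley {T} T∈ = connectionSet T , good⇒conditions T∈

    representatives : List (CayleyOf {m} (λ Ω → P ∣ Ω ∣))
    representatives = mapWith∈ goodHalves toCayley

    halfOf∈goodHalves : ∀ {Ω} → Admissible Ω → P ∣ Ω ∣ → halfOf Ω ∈ goodHalves
    halfOf∈goodHalves {Ω} adm PΩ = ∈-filter⁺ (λ T → T? (good T)) (filter-∈-sublists _ (halfRange n))
      (Equivalence.from BoolP.T-∧ (ℕP.≡⇒≡ᵇ _ 1 gcd≡1 , T-does⁺ (P? _) (subst P size PΩ)))
      where
      T-half : InHalf (halfOf Ω)
      T-half = ∈-sublists⇒⊆ (filter-∈-sublists (memberℕ Ω) (halfRange n))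
      gcd≡1 = generating⇒gcd≡1 (halfOf Ω) T-half
                (λ g → subst (λ Ω′ → Generated Ω′ g) (sym (connectionSet-halfOf adm)) (proj₂ (proj₂ adm) g))
      size = trans (cong ∣_∣ (sym (connectionSet-halfOf adm))) (∣connectionSet∣-sublist (filter-∈-sublists (memberℕ Ω) (halfRange n)))

    classCount : NumClasses {m} (λ Ω → P ∣ Ω ∣) (length goodHalves)
    classCount = representatives ,
      length-mapWith∈ (setoid (List ℕ)) goodHalves ,
      allPairs-mapWith∈ goodHalves toCayley
        (λ T∈ T′∈ T≢T′ Ω≈Ω′ → T≢T′ (connectionSet-injective (sub T∈) (sub T′∈) (equivalent⇒≡ Ω≈Ω′)))
        (AllPairsₚ.filter⁺ _ (unique-sublists (halfRange n) (unique-range 1 half))) ,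
      complete
      where
      sub : ∀ {T} → T ∈ goodHalves → T ∈ sublists (halfRange n)
      sub T∈ = proj₁ (∈-filter⁻ (λ T → T? (good T)) {xs = sublists (halfRange n)} T∈)
      complete : ∀ (A : CayleyOf {m} (λ Ω → P ∣ Ω ∣)) → Any (λ B → Equivalent (proj₁ A) (proj₁ B)) representatives
      complete (Ω , adm , PΩ) = mapWith∈⁺ toCayley
        (halfOf Ω , halfOf∈goodHalves adm PΩ , subst (Equivalent Ω) (sym (connectionSet-halfOf adm)) (equivalent-refl Ω))

    length-goodHalves : + length goodHalves ≡ coprimeSublistSum (λ w → when (does (P? w)) 1ℤ) n
    length-goodHalves = trans (length-filter≡∑ (λ T → T? (good T)) (sublists (halfRange n)))
                              (∑-cong (sublists (halfRange n)) (λ T → when-∧ (gcdWith n T ≡ᵇ 1) _ 1ℤ))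

-- The coefficients of Ψ and its value at 1

coprimeSublistSum-δ-large : ∀ m k → suc m ≤ k → coprimeSublistSum (δ k) (suc m) ≡ 0ℤ
coprimeSublistSum-δ-large m k m<k = ∑-zero (sublists (halfRange (suc m))) _ (λ T T∈ →
  trans (cong (λ b → when (gcdWith (suc m) T ≡ᵇ 1) (when b 1ℤ))
              (≡ᵇ-false (λ w≡k → ℕP.<⇒≱ m<k (subst (_≤ m) w≡k (ConnectionSets.weightSum≤m m T∈)))))
        (when-zero _))

coprimeSublistSum-split : ∀ n → coprimeSublistSum (λ _ → 1ℤ) n ≡ coprimeSublistSum (λ w → when (1 ≤ᵇ w) 1ℤ) n + when (n ≡ᵇ 1) 1ℤ
coprimeSublistSum-split n = trans
  (∑-cong (sublists (halfRange n)) (λ T → trans (cong (when (gcdWith n T ≡ᵇ 1)) (positive-or-zero (weightSum (weight n) T)))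
                                                (when-+ (gcdWith n T ≡ᵇ 1) _ _)))
  (trans (∑-+ (sublists (halfRange n)) _ _) (cong (λ s → coprimeSublistSum (λ w → when (1 ≤ᵇ w) 1ℤ) n + s) (coprimeSublistSum-δ0 n)))
  where
  positive-or-zero : ∀ w → 1ℤ ≡ when (1 ≤ᵇ w) 1ℤ + δ 0 w
  positive-or-zero zero    = refl
  positive-or-zero (suc w) = refl

∑-coprimeSublistSum-δ : ∀ m → ∑[ k ∈ range 0 (suc m) ] coprimeSublistSum (δ k) (suc m) ≡ coprimeSublistSum (λ _ → 1ℤ) (suc m)
∑-coprimeSublistSum-δ m = trans
  (∑-comm (range 0 (suc m)) (sublists (halfRange n)) (λ k T → when (gcdWith n T ≡ᵇ 1) (δ k (weightSum (weight n) T))))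
  (∑-cong-∈ (sublists (halfRange n)) (λ T T∈ → trans (∑-when (range 0 (suc m)) (gcdWith n T ≡ᵇ 1) _)
    (cong (when (gcdWith n T ≡ᵇ 1)) (trans
      (∑-cong (range 0 (suc m)) (λ k → cong (λ b → when b 1ℤ) (≡ᵇ-sym (weightSum (weight n) T) k)))
      (∑-range-indicator 0 (suc m) (weightSum (weight n) T) (λ _ → 1ℤ) z≤n (s≤s (ConnectionSets.weightSum≤m m T∈)))))))
  where n = suc m

∑-pconst1 : ∀ m (c : ℤ) → ∑[ k ∈ range 0 (suc m) ] (pconst 1ℤ k * c) ≡ c
∑-pconst1 m c = trans (cong (λ s → 1ℤ * c + s) (trans (∑-range-suc-shift 0 m _) (∑-zero (range 0 m) _ (λ k _ → refl))))
                      (trans (ℤP.+-identityʳ _) (ℤP.*-identityˡ c))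

a≡psiFormula : ∀ m k → 1 ≤ k → k < suc m → Σ ℕ λ c → a[ m , k ]≡ c × psiFormula (suc m) k ≡ + c
a≡psiFormula m k@(suc _) _ _ = length goodHalves , classCount ,
  trans (psiFormula≡ (suc m) (s≤s z≤n) k) (trans (ℤP.+-identityʳ _) (sym length-goodHalves))
  where open ConnectionSets.Representatives m (λ w → w ≟ k)

psiFormula-vanishes : ∀ m k → k ≡ 0 ⊎ suc m ≤ k → psiFormula (suc m) k ≡ + 0
psiFormula-vanishes m .0 (inj₁ refl) = trans (psiFormula≡ n (s≤s z≤n) 0)
  (trans (cong (_- 1ℤ * W) (coprimeSublistSum-δ0 n)) (x-1*x≡0 W))
  where
  n = suc m
  W = when (n ≡ᵇ 1) 1ℤ
  x-1*x≡0 : ∀ x → x - 1ℤ * x ≡ 0ℤ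
  x-1*x≡0 = solve-∀
psiFormula-vanishes m k (inj₂ m<k) = trans (psiFormula≡ (suc m) (s≤s z≤n) k)
  (cong₂ _-_ (coprimeSublistSum-δ-large m k m<k) (cong (_* _) (pconst-suc k m<k)))
  where
  pconst-suc : ∀ k → suc m ≤ k → pconst 1ℤ k ≡ 0ℤ
  pconst-suc (suc _) _ = refl

𝓔≡psiFormula : ∀ m → Σ ℕ λ c → 𝓔[ m ]≡ c × + c ≡ sumUpTo m (psiFormula (suc m)) × + c ≡ EFormula (suc m)
𝓔≡psiFormula m = length goodHalves , classCount , c≡∑ψ , c≡E
  where
  open ConnectionSets.Representatives m (λ w → 1 ≤? w)
  open ≡-Reasoning
  n = suc m
  W = when (n ≡ᵇ 1) 1ℤ
  N = coprimeSublistSum (λ w → when (1 ≤ᵇ w) 1ℤ) n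
  cancel : ∀ a b → (a + b) - b ≡ a
  cancel = solve-∀
  c≡E : + length goodHalves ≡ EFormula n
  c≡E = sym (begin
    EFormula n                                 ≡⟨ EFormula≡ n (s≤s z≤n) ⟩
    coprimeSublistSum (λ _ → 1ℤ) n - W         ≡⟨ cong (_- W) (coprimeSublistSum-split n) ⟩
    (N + W) - W                                ≡⟨ cancel N W ⟩
    N                                          ≡⟨ sym length-goodHalves ⟩
    + length goodHalves                        ∎)
  c≡∑ψ : + length goodHalves ≡ sumUpTo m (psiFormula n)
  c≡∑ψ = sym (begin
    sumUpTo m (psiFormula n)
      ≡⟨ sumUpTo≡∑ m (psiFormula n) ⟩
    ∑ (range 0 n) (psiFormula n)
      ≡⟨ ∑-cong (range 0 n) (psiFormula≡ n (s≤s z≤n)) ⟩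
    ∑[ k ∈ range 0 n ] (coprimeSublistSum (δ k) n - pconst 1ℤ k * W)
      ≡⟨ ∑-- (range 0 n) (λ k → coprimeSublistSum (δ k) n) (λ k → pconst 1ℤ k * W) ⟩
    ∑[ k ∈ range 0 n ] coprimeSublistSum (δ k) n - ∑[ k ∈ range 0 n ] (pconst 1ℤ k * W)
      ≡⟨ cong₂ _-_ (trans (∑-coprimeSublistSum-δ m) (coprimeSublistSum-split n)) (∑-pconst1 m W) ⟩
    (N + W) - W
      ≡⟨ cancel N W ⟩
    N
      ≡⟨ sym length-goodHalves ⟩
    + length goodHalves ∎)

corollary3p2 : (m : ℕ) →
    ((k : ℕ) → 1 ≤ k → k < suc m →
       Σ ℕ (λ c → (a[ m , k ]≡ c) × (psiFormula (suc m) k ≡ + c)))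
    × ((k : ℕ) → (k ≡ 0 ⊎ suc m ≤ k) → psiFormula (suc m) k ≡ + 0)
    × Σ ℕ (λ c → (𝓔[ m ]≡ c)
        × (+ c ≡ sumUpTo m (psiFormula (suc m)))
        × (+ c ≡ EFormula (suc m)))
corollary3p2 m = a≡psiFormula m , psiFormula-vanishes m , 𝓔≡psiFormula m
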